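{- Let $V\subset\mathbb{R}^d$ be finite with $\dim(\mathrm{conv}(V))=d$, and suppose $V$ is a pyramid with apex $v$, i.e. $\dim(\mathrm{conv}(V-\{v\}))=d-1$. Let $T$ be a lexicographic triangulation of $V$ given by some order of the points with pull/push choices. Then $T$ is also obtained if $v$ is moved to any position in the order and is either pulled or pushed (the other points keeping their relative order and pull/push choices). In fact, $T=\{B\cup\{v\}: B\in T'\}$, where $T'$ is the lexicographic triangulation of the base $V-\{v\}$ (within its affine hull) given by the induced order of the points of $V-\{v\}$ with the same pull/push choices.
   Context: A face of a finite set $X$ is $\emptyset$ or $X\cap H$ for a supporting hyperplane $H$ of $X$; a facet is a face of dimension $\dim\mathrm{conv}(X)-1$. For a finite set $Y$ with $\dim\mathrm{conv}(Y)=e$, a subdivision of $Y$ is a collection of subsets of $Y$ with $e$-dimensional convex hulls covering $\mathrm{conv}(Y)$, any two meeting in a common (possibly empty) face; a triangulation if each set has $e+1$ points. A facet $G$ of a set $X$ is visible from $u\in\mathrm{aff}(X)$ if $u$ lies in the open half of $\mathrm{aff}(X)$ bounded by $\mathrm{aff}(G)$ not containing $\mathrm{conv}(X)$. Pulling $u$ in a subdivision: sets not containing $u$ are kept; each set $S_j\ni u$ is replaced by all $G\cup\{u\}$, $G$ a facet of $S_j$ not containing $u$. Pushing $u$: sets not containing $u$ are kept; $S_j\ni u$ with $\dim\mathrm{conv}(S_j-\{u\})=\dim\mathrm{conv}(S_j)-1$ is kept; otherwise $S_j$ is replaced by $S_j-\{u\}$ and all $G\cup\{u\}$, $G$ a facet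 of $S_j-\{u\}$ visible from $u$. A lexicographic triangulation arises from the trivial subdivision $\{Y\}$ by pulling or pushing the points successively in a given order. -}

module Defs where

open import Level using (0ℓ)
open import Data.Nat as ℕ using (ℕ; zero; suc)
open import Data.Fin using (Fin; zero; suc)
open import Data.Fin.Subset using (Subset; _∈_; _∉_; _⊆_; _∪_; _-_; ⁅_⁆; ∣_∣; ⊤)
open import Data.Bool using (Bool; true; false)
open import Data.List using (List; []; _∷_)
open import Data.Product using (Σ; ∃; _×_; _,_)
open import Data.Sum using (_⊎_)
open import Data.Empty using (⊥)
open import Relation.Nullary using (¬_)
open import Relation.Binary.PropositionalEquality using (_≡_; _≢_)
open import Algebra.Structures using (IsCommutativeRing)
open import Function.Bundles using (_⇔_)

-- An ordered field (the paper works over ℝ, which is an instance;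
-- the standard library has no real numbers).  Axioms are the usual
-- ordered-field axioms (with trichotomy, true classically for ℝ).

record OrderedField : Set₁ where
  infixl 6 _+_
  infixl 7 _*_
  infix 4 _<_ _≤_
  field
    Carrier : Set
    _+_ _*_ : Carrier → Carrier → Carrier
    -_ : Carrier → Carrier
    0# 1# : Carrier
    _<_ : Carrier → Carrier → Set
    isCommutativeRing : IsCommutativeRing _≡_ _+_ _*_ -_ 0# 1#
    0≢1 : 0# ≢ 1#
    inverse : ∀ x → x ≢ 0# → ∃ λ y → x * y ≡ 1#
    <-irrefl : ∀ x → ¬ (x < x)
    <-trans : ∀ {x y z} → x < y → y < z → x < z
    <-tri : ∀ x y → x < y ⊎ x ≡ y ⊎ y < x
    +-mono-< : ∀ {x y} z → x < y → x + z < y + z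
    *-pos : ∀ {x y} → 0# < x → 0# < y → 0# < x * y

  _≤_ : Carrier → Carrier → Set
  x ≤ y = x < y ⊎ x ≡ y

module Geometry (F : OrderedField) {d n : ℕ} (p : Fin n → Fin d → OrderedField.Carrier F) where
  open OrderedField F

  Σᶠ : {m : ℕ} → (Fin m → Carrier) → Carrier
  Σᶠ {zero} f = 0#
  Σᶠ {suc m} f = f zero + Σᶠ (λ i → f (suc i))

  _·_ : (Fin d → Carrier) → (Fin d → Carrier) → Carrier
  a · x = Σᶠ (λ k → a k * x k)

  SupportedOn : Subset n → (Fin n → Carrier) → Set
  SupportedOn X μ = ∀ i → i ∉ X → μ i ≡ 0#

  comb : (Fin n → Carrier) → Fin d → Carrier
  comb μ k = Σᶠ (λ i → μ i * p i k)

  InAff : Subset n → (Fin d → Carrier) → Set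
  InAff X x = ∃ λ μ → SupportedOn X μ × Σᶠ μ ≡ 1# × (∀ k → comb μ k ≡ x k)

  AffIndep : Subset n → Set
  AffIndep A = ∀ μ → SupportedOn A μ → Σᶠ μ ≡ 0# → (∀ k → comb μ k ≡ 0#)
             → ∀ i → μ i ≡ 0#

  -- AffRank X r  :  r = dim conv(X) + 1  (maximal size of an affinely
  -- independent subset of X; r = 0 iff X = ∅)
  AffRank : Subset n → ℕ → Set
  AffRank X r = (∃ λ A → A ⊆ X × AffIndep A × ∣ A ∣ ≡ r)
              × (∀ A → A ⊆ X → AffIndep A → ∣ A ∣ ℕ.≤ r)

  Face : Subset n → Subset n → Set
  Face X G = (∀ i → i ∉ G)
           ⊎ (∃ λ a → ∃ λ b → (∃ λ k → a k ≢ 0#)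
                × (∀ i → i ∈ X → a · p i ≤ b)
                × (∀ i → (i ∈ G) ⇔ (i ∈ X × a · p i ≡ b)))

  Facet : Subset n → Subset n → Set
  Facet X G = Face X G × ∃ λ r → AffRank X (suc r) × AffRank G r

  -- facet G of X is visible from point u (u ∈ aff X): u lies strictly on
  -- the other side (inside aff X) of the hyperplane aff G from conv X.
  -- Any affine functional (a,b) that is ≤ b on X, = b on G and not
  -- constant b on X cuts out exactly aff G inside aff X.
  Visible : Subset n → Subset n → Fin n → Set
  Visible X G u = Facet X G × InAff X (p u)
                × (∃ λ a → ∃ λ b → (∀ i → i ∈ X → a · p i ≤ b)
                     × (∀ i → i ∈ G → a · p i ≡ b)
                     × (∃ λ i → i ∈ X × a · p i < b)
                     × b < a · p u)

  Coll : Set₁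
  Coll = Subset n → Set

  _≐_ : Coll → Coll → Set
  C ≐ D = ∀ S → C S ⇔ D S

  DropsDim : Subset n → Fin n → Set
  DropsDim S u = ∃ λ r → AffRank S (suc r) × AffRank (S - u) r

  pull : Fin n → Coll → Coll
  pull u C S = (C S × u ∉ S)
             ⊎ (∃ λ Sj → C Sj × u ∈ Sj ×
                  (∃ λ G → Facet Sj G × u ∉ G × S ≡ G ∪ ⁅ u ⁆))

  push : Fin n → Coll → Coll
  push u C S = (C S × u ∉ S)
             ⊎ (C S × u ∈ S × DropsDim S u)
             ⊎ (∃ λ Sj → C Sj × u ∈ Sj × ¬ DropsDim Sj u ×
                  (S ≡ Sj - u
                   ⊎ (∃ λ G → Facet (Sj - u) G × Visible (Sj - u) G u
                        × S ≡ G ∪ ⁅ u ⁆)))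

  step : Bool → Fin n → Coll → Coll
  step true u = pull u
  step false u = push u

  trivial : Subset n → Coll
  trivial Y S = S ≡ Y

  run : List (Fin n) → (Fin n → Bool) → Coll → Coll
  run [] c C = C
  run (u ∷ us) c C = run us c (step (c u) u C)

  lex : Subset n → List (Fin n) → (Fin n → Bool) → Coll
  lex Y ord c = run ord c (trivial Y)

open import Data.List using (filter; take; drop; _++_)
open import Data.List.Relation.Unary.Unique.Propositional using (Unique)
import Data.List.Membership.Propositional as LM
open import Data.Fin using (_≟_)
open import Relation.Nullary.Decidable using (¬?)
open import Function.Definitions using (Injective)

IsOrderOf : {n : ℕ} → Subset n → List (Fin n) → Set
IsOrderOf Y ord = Unique ord × (∀ i → (i ∈ Y) ⇔ (i LM.∈ ord))

without : {n : ℕ} → Fin n → List (Fin n) → List (Fin n)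
without v ord = filter (λ i → ¬? (i ≟ v)) ord

-- insert v at position k (k ≥ length: at the end)
insertAt : {n : ℕ} → ℕ → Fin n → List (Fin n) → List (Fin n)
insertAt k v ord = take k ord ++ (v ∷ drop k ord)

-- The base V - {v} lies on a hyperplane h · x = c that misses the apex. Therefore every cell
-- arising from the trivial subdivision {V} is a cone B ∪ {v} over a cell B of a subdivision of the
-- base, and the facets of such a cone are B itself and the cones over the facets of B. Pulling or
-- pushing the apex then changes nothing, while pulling or pushing a base point u commutes with
-- taking cones: supporting hyperplanes of B, tilted by a multiple of (h, c), pass through the apex
-- and keep visibility from u. Induction along the order gives T = {B ∪ {v} : B ∈ T′}, and T′ does
-- not see where v sits in the order or whether it is pulled or pushed.

module Submission where

open import Data.Nat as ℕ using (ℕ; zero; suc)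
import Data.Nat.Properties as ℕ
open import Data.Integer as ℤ using (ℤ; -[1+_]; _⊖_)
import Data.Integer.Properties as ℤ
open import Data.Maybe using (Maybe; just; nothing)
open import Data.Fin using (Fin; zero; suc; _≟_)
open import Data.Fin.Properties using (suc-injective; all?; ¬∀⟶∃¬)
open import Data.Fin.Subset using (Subset; _∈_; _∉_; _⊆_; _∪_; _-_; ⁅_⁆; ∣_∣; ⊤; inside; outside)
  renaming (⊥ to ∅)
open import Data.Fin.Subset.Properties
  using (_∈?_; x∈p∪q⁻; x∈p∪q⁺; x∈⁅y⁆⇒x≡y; x∈⁅x⁆; ⊆-antisym; x∈p∧x≢y⇒x∈p-y; p─q⊆p; p─⊥≡p;
         nonempty?; Empty-unique; ∣⊥∣≡0; p⊆q⇒∣p∣≤∣q∣; ∈⊤; ∉⊥)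
open import Data.Vec using (_∷_; here; there)
open import Data.Bool using (Bool; true; false)
open import Data.List using (List; []; _∷_; allFin; take; drop; _++_)
open import Data.List.Properties using (filter-reject; filter-++; filter-idem; take++drop≡id)
import Data.List.Membership.Propositional as List
open import Data.List.Membership.Propositional.Properties using (∈-allFin; ∈-filter⁻)
open import Data.List.Relation.Unary.Any using (here; there)
open import Data.Product using (∃; _×_; _,_; proj₁; proj₂)
open import Data.Sum using (_⊎_; inj₁; inj₂; [_,_]′)
open import Data.Empty using (⊥; ⊥-elim)
open import Relation.Nullary using (¬_; Dec; yes; no)
open import Relation.Nullary.Decidable using (¬?; _→-dec_)
open import Relation.Binary.PropositionalEquality
open import Function.Base using (_∘_)
open import Function.Bundles using (_⇔_; mk⇔; Equivalence)
open import Function.Definitions using (Injective)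
open import Function.Properties.Equivalence using (⇔-isEquivalence)
open import Relation.Binary.Structures using (IsEquivalence)
open import Level using (0ℓ)
open import Algebra.Structures using (IsCommutativeRing)
open import Algebra.Bundles using (CommutativeRing)
import Algebra.Solver.Ring.AlmostCommutativeRing as ACR

open import Defs

-- Coefficients taken in the field itself would not compute, so that e.g. x + - x = 0 could not be
-- decided by normalisation; the solver is therefore instantiated with integer coefficients.
module IntegerRingSolver (F : OrderedField) where
  open OrderedField F
  open IsCommutativeRing isCommutativeRing using (+-identityˡ; +-identityʳ; +-assoc; +-comm; -‿inverseʳ)

  ring : CommutativeRing _ _
  ring = record { isCommutativeRing = isCommutativeRing }

  open import Algebra.Properties.Ring (CommutativeRing.ring ring)
    using (-‿distribˡ-*; -‿distribʳ-*; -‿involutive; -0#≈0#; -‿+-comm; +-cancelʳ)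
  open import Algebra.Properties.Semiring.Mult (CommutativeRing.semiring ring)
    using (×-homo-+; ×1-homo-*)
    renaming (_×_ to _×′_)

  fromℕ : ℕ → Carrier
  fromℕ n = n ×′ 1#

  fromℤ : ℤ → Carrier
  fromℤ (ℤ.+ n) = fromℕ n
  fromℤ -[1+ n ] = - fromℕ (suc n)

  fromℤ-homo-neg : ∀ i → fromℤ (ℤ.- i) ≡ - fromℤ i
  fromℤ-homo-neg -[1+ n ] = sym (-‿involutive _)
  fromℤ-homo-neg (ℤ.+ zero) = sym -0#≈0#
  fromℤ-homo-neg (ℤ.+ suc n) = refl

  fromℤ-homo-⊖ : ∀ m n → fromℤ (m ⊖ n) ≡ fromℕ m + - fromℕ n
  fromℤ-homo-⊖ m zero = begin
    fromℤ (m ⊖ 0)        ≡⟨ cong fromℤ (ℤ.⊖-≥ {m} ℕ.z≤n) ⟩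
    fromℕ m              ≡⟨ sym (+-identityʳ _) ⟩
    fromℕ m + 0#         ≡⟨ cong (fromℕ m +_) (sym -0#≈0#) ⟩
    fromℕ m + - 0#       ∎
    where open ≡-Reasoning
  fromℤ-homo-⊖ zero (suc n) = begin
    fromℤ (0 ⊖ suc n)        ≡⟨ cong fromℤ (ℤ.⊖-< {0} {suc n} (ℕ.s≤s ℕ.z≤n)) ⟩
    - fromℕ (suc n)          ≡⟨ sym (+-identityˡ _) ⟩
    0# + - fromℕ (suc n)     ∎
    where open ≡-Reasoning
  fromℤ-homo-⊖ (suc m) (suc n) = begin
    fromℤ (suc m ⊖ suc n)                    ≡⟨ cong fromℤ (ℤ.[1+m]⊖[1+n]≡m⊖n m n) ⟩
    fromℤ (m ⊖ n)                            ≡⟨ fromℤ-homo-⊖ m n ⟩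
    fromℕ m + - fromℕ n                      ≡⟨ cong (_+ - fromℕ n) (sym (+-identityˡ _)) ⟩
    0# + fromℕ m + - fromℕ n                 ≡⟨ cong (λ z → z + fromℕ m + - fromℕ n) (sym (-‿inverseʳ 1#)) ⟩
    1# + - 1# + fromℕ m + - fromℕ n          ≡⟨ cong (_+ - fromℕ n) (+-assoc 1# (- 1#) (fromℕ m)) ⟩
    1# + (- 1# + fromℕ m) + - fromℕ n        ≡⟨ cong (λ z → 1# + z + - fromℕ n) (+-comm (- 1#) (fromℕ m)) ⟩
    1# + (fromℕ m + - 1#) + - fromℕ n        ≡⟨ cong (_+ - fromℕ n) (sym (+-assoc 1# (fromℕ m) (- 1#))) ⟩
    1# + fromℕ m + - 1# + - fromℕ n          ≡⟨ +-assoc (1# + fromℕ m) (- 1#) (- fromℕ n) ⟩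
    1# + fromℕ m + (- 1# + - fromℕ n)        ≡⟨ cong (1# + fromℕ m +_) (-‿+-comm 1# (fromℕ n)) ⟩
    fromℕ (suc m) + - fromℕ (suc n)          ∎
    where open ≡-Reasoning

  fromℤ-homo-+ : ∀ i j → fromℤ (i ℤ.+ j) ≡ fromℤ i + fromℤ j
  fromℤ-homo-+ -[1+ m ] -[1+ n ] = begin
    - fromℕ (suc (suc (m ℕ.+ n)))        ≡⟨ cong (λ k → - fromℕ (suc k)) (sym (ℕ.+-suc m n)) ⟩
    - fromℕ (suc m ℕ.+ suc n)            ≡⟨ cong -_ (×-homo-+ 1# (suc m) (suc n)) ⟩
    - (fromℕ (suc m) + fromℕ (suc n))    ≡⟨ sym (-‿+-comm _ _) ⟩
    - fromℕ (suc m) + - fromℕ (suc n)    ∎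
    where open ≡-Reasoning
  fromℤ-homo-+ -[1+ m ] (ℤ.+ n) = trans (fromℤ-homo-⊖ n (suc m)) (+-comm _ _)
  fromℤ-homo-+ (ℤ.+ m) -[1+ n ] = fromℤ-homo-⊖ m (suc n)
  fromℤ-homo-+ (ℤ.+ m) (ℤ.+ n) = ×-homo-+ 1# m n

  fromℤ-homo-* : ∀ i j → fromℤ (i ℤ.* j) ≡ fromℤ i * fromℤ j
  fromℤ-homo-* (ℤ.+ m) (ℤ.+ n) = trans (cong fromℤ (ℤ.+◃n≡+n (m ℕ.* n))) (×1-homo-* m n)
  fromℤ-homo-* (ℤ.+ m) -[1+ n ] = begin
    fromℤ (ℤ.+ m ℤ.* -[1+ n ])             ≡⟨ cong fromℤ (ℤ.-◃n≡-n (m ℕ.* suc n)) ⟩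
    fromℤ (ℤ.- (ℤ.+ (m ℕ.* suc n)))        ≡⟨ fromℤ-homo-neg (ℤ.+ (m ℕ.* suc n)) ⟩
    - fromℕ (m ℕ.* suc n)                ≡⟨ cong -_ (×1-homo-* m (suc n)) ⟩
    - (fromℕ m * fromℕ (suc n))          ≡⟨ -‿distribʳ-* _ _ ⟩
    fromℕ m * - fromℕ (suc n)            ∎
    where open ≡-Reasoning
  fromℤ-homo-* -[1+ m ] (ℤ.+ n) = begin
    fromℤ (-[1+ m ] ℤ.* ℤ.+ n)             ≡⟨ cong fromℤ (ℤ.-◃n≡-n (suc m ℕ.* n)) ⟩
    fromℤ (ℤ.- (ℤ.+ (suc m ℕ.* n)))        ≡⟨ fromℤ-homo-neg (ℤ.+ (suc m ℕ.* n)) ⟩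
    - fromℕ (suc m ℕ.* n)                ≡⟨ cong -_ (×1-homo-* (suc m) n) ⟩
    - (fromℕ (suc m) * fromℕ n)          ≡⟨ -‿distribˡ-* _ _ ⟩
    - fromℕ (suc m) * fromℕ n            ∎
    where open ≡-Reasoning
  fromℤ-homo-* -[1+ m ] -[1+ n ] = begin
    fromℤ (-[1+ m ] ℤ.* -[1+ n ])            ≡⟨ cong fromℤ (ℤ.+◃n≡+n (suc m ℕ.* suc n)) ⟩
    fromℕ (suc m ℕ.* suc n)                  ≡⟨ ×1-homo-* (suc m) (suc n) ⟩
    fromℕ (suc m) * fromℕ (suc n)            ≡⟨ sym (-‿involutive _) ⟩
    - - (fromℕ (suc m) * fromℕ (suc n))      ≡⟨ cong -_ (-‿distribˡ-* _ _) ⟩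
    - (- fromℕ (suc m) * fromℕ (suc n))      ≡⟨ -‿distribʳ-* _ _ ⟩
    - fromℕ (suc m) * - fromℕ (suc n)        ∎
    where open ≡-Reasoning

  homomorphism : ℤ.+-*-rawRing ACR.-Raw-AlmostCommutative⟶ ACR.fromCommutativeRing ring
  homomorphism = record
    { ⟦_⟧ = fromℤ ; +-homo = fromℤ-homo-+ ; *-homo = fromℤ-homo-* ; -‿homo = fromℤ-homo-neg
    ; 0-homo = refl ; 1-homo = +-identityʳ 1# }

  fromℤ-≟ : ∀ i j → Maybe (fromℤ i ≡ fromℤ j)
  fromℤ-≟ i j with i ℤ.≟ j
  ... | yes i≡j = just (cong fromℤ i≡j)
  ... | no _ = nothing

  open import Algebra.Solver.Ring ℤ.+-*-rawRing (ACR.fromCommutativeRing ring) homomorphism fromℤ-≟ public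
    using (solve; _:=_; _:+_; _:*_; :-_)

module OrderedFieldProperties (F : OrderedField) where
  open OrderedField F public
  open IsCommutativeRing isCommutativeRing public
    using (+-assoc; +-comm; +-identityˡ; +-identityʳ; *-assoc; *-comm; *-identityˡ; *-identityʳ;
           distribˡ; distribʳ; -‿inverseˡ; -‿inverseʳ; zeroˡ; zeroʳ)
  open IntegerRingSolver F public using (solve; _:=_; _:+_; _:*_; :-_)
  open import Algebra.Properties.Ring (CommutativeRing.ring (IntegerRingSolver.ring F)) public
    using (-0#≈0#; +-cancelʳ; +-inverseˡ-unique; x∙y⁻¹≈ε⇒x≈y)

  <⇒≢ : ∀ {x y} → x < y → x ≢ y
  <⇒≢ {y = y} x<y refl = <-irrefl y x<y

  infix 4 _≟ᶠ_
  _≟ᶠ_ : (x y : Carrier) → Dec (x ≡ y)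
  x ≟ᶠ y with <-tri x y
  ... | inj₁ x<y = no (<⇒≢ x<y)
  ... | inj₂ (inj₁ x≡y) = yes x≡y
  ... | inj₂ (inj₂ y<x) = no (λ x≡y → <⇒≢ y<x (sym x≡y))

  infix 25 _⁻¹⟨_⟩
  _⁻¹⟨_⟩ : (x : Carrier) → x ≢ 0# → Carrier
  x ⁻¹⟨ x≢0 ⟩ = proj₁ (inverse x x≢0)

  *-inverseʳ : (x : Carrier) (x≢0 : x ≢ 0#) → x * x ⁻¹⟨ x≢0 ⟩ ≡ 1#
  *-inverseʳ x x≢0 = proj₂ (inverse x x≢0)

  x*y≡0⇒y≡0 : ∀ {x y} → x ≢ 0# → x * y ≡ 0# → y ≡ 0#
  x*y≡0⇒y≡0 {x} {y} x≢0 xy≡0 = begin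
    y                  ≡⟨ sym (*-identityˡ y) ⟩
    1# * y             ≡⟨ cong (_* y) (sym (*-inverseʳ x x≢0)) ⟩
    x * x⁻¹ * y        ≡⟨ solve 3 (λ x x⁻¹ y → x :* x⁻¹ :* y := x⁻¹ :* (x :* y)) refl x x⁻¹ y ⟩
    x⁻¹ * (x * y)      ≡⟨ cong (x⁻¹ *_) xy≡0 ⟩
    x⁻¹ * 0#           ≡⟨ zeroʳ x⁻¹ ⟩
    0#                 ∎
    where open ≡-Reasoning
          x⁻¹ = x ⁻¹⟨ x≢0 ⟩

  y*x⁻¹*x≡y : ∀ y {x} (x≢0 : x ≢ 0#) → y * x ⁻¹⟨ x≢0 ⟩ * x ≡ y
  y*x⁻¹*x≡y y {x} x≢0 = begin
    y * x⁻¹ * x        ≡⟨ solve 3 (λ y x⁻¹ x → y :* x⁻¹ :* x := y :* (x :* x⁻¹)) refl y x⁻¹ x ⟩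
    y * (x * x⁻¹)      ≡⟨ cong (y *_) (*-inverseʳ x x≢0) ⟩
    y * 1#             ≡⟨ *-identityʳ y ⟩
    y                  ∎
    where open ≡-Reasoning
          x⁻¹ = x ⁻¹⟨ x≢0 ⟩

  +-monoˡ-≤ : ∀ {x y} z → x ≤ y → x + z ≤ y + z
  +-monoˡ-≤ z (inj₁ x<y) = inj₁ (+-mono-< z x<y)
  +-monoˡ-≤ z (inj₂ x≡y) = inj₂ (cong (_+ z) x≡y)

  ≤∧≢⇒< : ∀ {x y} → x ≤ y → x ≢ y → x < y
  ≤∧≢⇒< (inj₁ x<y) _ = x<y
  ≤∧≢⇒< (inj₂ x≡y) x≢y = ⊥-elim (x≢y x≡y)

  neg-mono-< : ∀ {x y} → x < y → - y < - x
  neg-mono-< {x} {y} x<y = subst₂ _<_ (solve 2 (λ x y → x :+ (:- x :+ :- y) := :- y) refl x y)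
                                      (solve 2 (λ x y → y :+ (:- x :+ :- y) := :- x) refl x y)
                                      (+-mono-< (- x + - y) x<y)

  0<1 : 0# < 1#
  0<1 with <-tri 0# 1#
  ... | inj₁ 0<1 = 0<1
  ... | inj₂ (inj₁ 0≡1) = ⊥-elim (0≢1 0≡1)
  ... | inj₂ (inj₂ 1<0) = ⊥-elim (<-irrefl 0# (<-trans 0<[-1]² 1<0))
    where
    0<-1 : 0# < - 1#
    0<-1 = subst₂ _<_ (-‿inverseʳ 1#) (+-identityˡ (- 1#)) (+-mono-< (- 1#) 1<0)
    0<[-1]² : 0# < 1#
    0<[-1]² = subst (0# <_) (trans (solve 1 (λ u → :- u :* :- u := u :* u) refl 1#) (*-identityˡ 1#))
                (*-pos 0<-1 0<-1)

  x<x+1 : ∀ x → x < x + 1#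
  x<x+1 x = subst₂ _<_ (+-identityˡ x) (+-comm 1# x) (+-mono-< x 0<1)

module SubsetProperties where
  private variable
    m : ℕ
    x y : Fin m
    p : Subset m

  x∈p-y⇒x∈p : x ∈ p - y → x ∈ p
  x∈p-y⇒x∈p {p = p} {y = y} = p─q⊆p p ⁅ y ⁆

  x∈p-y⇒x≢y : x ∈ p - y → x ≢ y
  x∈p-y⇒x≢y {p = _ ∷ p} {y = zero} (there x∈p-y) ()
  x∈p-y⇒x≢y {p = _ ∷ p} {y = suc y} (there x∈p-y) refl = x∈p-y⇒x≢y {p = p} x∈p-y refl
  x∈p-y⇒x≢y {p = inside ∷ p} {y = suc y} here ()

  x∉p-x : x ∉ p - x
  x∉p-x x∈p-x = x∈p-y⇒x≢y x∈p-x refl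

  x∈p∪⁅y⁆⁻ : x ∈ p ∪ ⁅ y ⁆ → x ∈ p ⊎ x ≡ y
  x∈p∪⁅y⁆⁻ {p = p} {y = y} x∈p∪y = Data.Sum.map₂ (x∈⁅y⁆⇒x≡y y) (x∈p∪q⁻ p ⁅ y ⁆ x∈p∪y)

  x∈p∪⁅y⁆∧x≢y⇒x∈p : x ∈ p ∪ ⁅ y ⁆ → x ≢ y → x ∈ p
  x∈p∪⁅y⁆∧x≢y⇒x∈p x∈p∪y x≢y = [ (λ x∈p → x∈p) , ⊥-elim ∘ x≢y ]′ (x∈p∪⁅y⁆⁻ x∈p∪y)

  x∉p∧x≢y⇒x∉p∪⁅y⁆ : x ∉ p → x ≢ y → x ∉ p ∪ ⁅ y ⁆
  x∉p∧x≢y⇒x∉p∪⁅y⁆ x∉p x≢y x∈p∪y = x∉p (x∈p∪⁅y⁆∧x≢y⇒x∈p x∈p∪y x≢y)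

  y∈p∪⁅y⁆ : ∀ (p : Subset m) y → y ∈ p ∪ ⁅ y ⁆
  y∈p∪⁅y⁆ p y = x∈p∪q⁺ (inj₂ (x∈⁅x⁆ y))

  ∪⁅⁆-⊆ : ∀ {p q : Subset m} {x} → p ⊆ q → x ∈ q → p ∪ ⁅ x ⁆ ⊆ q
  ∪⁅⁆-⊆ {q = q} p⊆q x∈q y∈ = [ p⊆q , (λ { refl → x∈q }) ]′ (x∈p∪⁅y⁆⁻ y∈)

  ∪⁅⁆-monoˡ : ∀ {p q : Subset m} {x} → p ⊆ q → p ∪ ⁅ x ⁆ ⊆ q ∪ ⁅ x ⁆
  ∪⁅⁆-monoˡ {q = q} {x} p⊆q = ∪⁅⁆-⊆ (λ y∈p → x∈p∪q⁺ (inj₁ (p⊆q y∈p))) (y∈p∪⁅y⁆ q x)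

  ∣p∣≡1+∣p-x∣ : ∀ (p : Subset m) x → x ∈ p → ∣ p ∣ ≡ suc ∣ p - x ∣
  ∣p∣≡1+∣p-x∣ (inside ∷ p) zero here = cong suc (sym (cong ∣_∣ (p─⊥≡p p)))
  ∣p∣≡1+∣p-x∣ (inside ∷ p) (suc x) (there x∈p) = cong suc (∣p∣≡1+∣p-x∣ p x x∈p)
  ∣p∣≡1+∣p-x∣ (outside ∷ p) (suc x) (there x∈p) = ∣p∣≡1+∣p-x∣ p x x∈p

  ∣p∣≡1+s⇒∣p-x∣≡s : ∀ (p : Subset m) {s} → x ∈ p → ∣ p ∣ ≡ suc s → ∣ p - x ∣ ≡ s
  ∣p∣≡1+s⇒∣p-x∣≡s p x∈p ∣p∣≡1+s = ℕ.suc-injective (trans (sym (∣p∣≡1+∣p-x∣ p _ x∈p)) ∣p∣≡1+s)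

  ∣p∣≡1+s⇒nonempty : ∀ (p : Subset m) {s} → ∣ p ∣ ≡ suc s → ∃ λ x → x ∈ p
  ∣p∣≡1+s⇒nonempty {m} p ∣p∣≡1+s with nonempty? p
  ... | yes p≢∅ = p≢∅
  ... | no p≡∅ = ⊥-elim (ℕ.0≢1+n (trans (sym (∣⊥∣≡0 m))
                                         (trans (cong ∣_∣ (sym (Empty-unique p≡∅))) ∣p∣≡1+s)))

  ∣p∣≡0⇒x∉p : ∀ (p : Subset m) → ∣ p ∣ ≡ 0 → x ∉ p
  ∣p∣≡0⇒x∉p p ∣p∣≡0 x∈p with trans (sym (∣p∣≡1+∣p-x∣ p _ x∈p)) ∣p∣≡0
  ... | ()

  p-x∪⁅x⁆≡p : x ∈ p → (p - x) ∪ ⁅ x ⁆ ≡ p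
  p-x∪⁅x⁆≡p {x = x} {p = p} x∈p = ⊆-antisym ⊆p p⊆
    where
    ⊆p : (p - x) ∪ ⁅ x ⁆ ⊆ p
    ⊆p = ∪⁅⁆-⊆ x∈p-y⇒x∈p x∈p
    p⊆ : p ⊆ (p - x) ∪ ⁅ x ⁆
    p⊆ {y} y∈p with y ≟ x
    ... | yes refl = y∈p∪⁅y⁆ (p - x) x
    ... | no y≢x = x∈p∪q⁺ (inj₁ (x∈p∧x≢y⇒x∈p-y y∈p y≢x))

  p∪⁅x⁆-x≡p : x ∉ p → (p ∪ ⁅ x ⁆) - x ≡ p
  p∪⁅x⁆-x≡p {x = x} {p = p} x∉p = ⊆-antisym
    (λ y∈ → x∈p∪⁅y⁆∧x≢y⇒x∈p (x∈p-y⇒x∈p y∈) (x∈p-y⇒x≢y y∈))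
    (λ y∈p → x∈p∧x≢y⇒x∈p-y (x∈p∪q⁺ (inj₁ y∈p)) (λ { refl → x∉p y∈p }))

  p∪⁅x⁆-y≡p-y∪⁅x⁆ : y ≢ x → (p ∪ ⁅ x ⁆) - y ≡ (p - y) ∪ ⁅ x ⁆
  p∪⁅x⁆-y≡p-y∪⁅x⁆ {y = y} {x = x} {p = p} y≢x = ⊆-antisym ⊆r r⊆
    where
    ⊆r : (p ∪ ⁅ x ⁆) - y ⊆ (p - y) ∪ ⁅ x ⁆
    ⊆r {z} z∈ with z ≟ x
    ... | yes refl = y∈p∪⁅y⁆ (p - y) z
    ... | no z≢x =
      x∈p∪q⁺ (inj₁ (x∈p∧x≢y⇒x∈p-y (x∈p∪⁅y⁆∧x≢y⇒x∈p (x∈p-y⇒x∈p z∈) z≢x) (x∈p-y⇒x≢y z∈)))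
    r⊆ : (p - y) ∪ ⁅ x ⁆ ⊆ (p ∪ ⁅ x ⁆) - y
    r⊆ = ∪⁅⁆-⊆ (λ z∈ → x∈p∧x≢y⇒x∈p-y (x∈p∪q⁺ (inj₁ (x∈p-y⇒x∈p z∈))) (x∈p-y⇒x≢y z∈))
               (x∈p∧x≢y⇒x∈p-y (y∈p∪⁅y⁆ p x) (y≢x ∘ sym))

  ∣p∪⁅x⁆∣≡1+∣p∣ : ∀ (p : Subset m) x → x ∉ p → ∣ p ∪ ⁅ x ⁆ ∣ ≡ suc ∣ p ∣
  ∣p∪⁅x⁆∣≡1+∣p∣ p x x∉p =
    trans (∣p∣≡1+∣p-x∣ (p ∪ ⁅ x ⁆) x (y∈p∪⁅y⁆ p x)) (cong (λ q → suc ∣ q ∣) (p∪⁅x⁆-x≡p x∉p))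

  ∪⁅⁆-comm : ∀ (p : Subset m) x y → (p ∪ ⁅ x ⁆) ∪ ⁅ y ⁆ ≡ (p ∪ ⁅ y ⁆) ∪ ⁅ x ⁆
  ∪⁅⁆-comm p x y = ⊆-antisym (swap x y) (swap y x)
    where
    swap : ∀ x y → (p ∪ ⁅ x ⁆) ∪ ⁅ y ⁆ ⊆ (p ∪ ⁅ y ⁆) ∪ ⁅ x ⁆
    swap x y = ∪⁅⁆-⊆ (∪⁅⁆-⊆ (x∈p∪q⁺ ∘ inj₁ ∘ x∈p∪q⁺ ∘ inj₁) (y∈p∪⁅y⁆ (p ∪ ⁅ y ⁆) x))
                     (x∈p∪q⁺ (inj₁ (y∈p∪⁅y⁆ p y)))

module OrderProperties {n : ℕ} (v : Fin n) where
  without-∷-self : ∀ L → without v (v ∷ L) ≡ without v L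
  without-∷-self L = filter-reject (λ i → ¬? (i ≟ v)) (λ ¬v≢v → ¬v≢v refl)

  ∈-without⇒≢ : ∀ {u} L → u List.∈ without v L → u ≢ v
  ∈-without⇒≢ L u∈ = proj₂ (∈-filter⁻ (λ i → ¬? (i ≟ v)) {xs = L} u∈)

  without-insertAt : ∀ k L → without v (insertAt k v (without v L)) ≡ without v L
  without-insertAt k L = begin
    without v (take k L′ ++ v ∷ drop k L′)
      ≡⟨ filter-++ v≢? (take k L′) (v ∷ drop k L′) ⟩
    without v (take k L′) ++ without v (v ∷ drop k L′)
      ≡⟨ cong (without v (take k L′) ++_) (without-∷-self (drop k L′)) ⟩
    without v (take k L′) ++ without v (drop k L′)
      ≡⟨ sym (filter-++ v≢? (take k L′) (drop k L′)) ⟩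
    without v (take k L′ ++ drop k L′)
      ≡⟨ cong (without v) (take++drop≡id k L′) ⟩
    without v (without v L)
      ≡⟨ filter-idem v≢? L ⟩
    without v L ∎
    where open ≡-Reasoning
          L′ = without v L
          v≢? = λ i → ¬? (i ≟ v)

-- Σᶠ is only available inside 'Geometry F p', so the lemmas on finite sums
-- are stated there too, although they do not involve the configuration p.
module FiniteSums (F : OrderedField) {d n : ℕ} (p : Fin n → Fin d → OrderedField.Carrier F) where
  open OrderedFieldProperties F public
  open Geometry F p public

  Σᶠ-cong : ∀ {m} {f g : Fin m → Carrier} → (∀ i → f i ≡ g i) → Σᶠ f ≡ Σᶠ g
  Σᶠ-cong {zero} f≗g = refl
  Σᶠ-cong {suc m} f≗g = cong₂ _+_ (f≗g zero) (Σᶠ-cong (λ i → f≗g (suc i)))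

  Σᶠ-zero : ∀ {m} {f : Fin m → Carrier} → (∀ i → f i ≡ 0#) → Σᶠ f ≡ 0#
  Σᶠ-zero {zero} f≗0 = refl
  Σᶠ-zero {suc m} f≗0 = trans (cong₂ _+_ (f≗0 zero) (Σᶠ-zero (λ i → f≗0 (suc i)))) (+-identityˡ 0#)

  Σᶠ-distrib-+ : ∀ {m} (f g : Fin m → Carrier) → Σᶠ (λ i → f i + g i) ≡ Σᶠ f + Σᶠ g
  Σᶠ-distrib-+ {zero} f g = sym (+-identityˡ 0#)
  Σᶠ-distrib-+ {suc m} f g =
    trans (cong (f zero + g zero +_) (Σᶠ-distrib-+ (λ i → f (suc i)) (λ i → g (suc i))))
          (solve 4 (λ a b c d → a :+ b :+ (c :+ d) := a :+ c :+ (b :+ d)) refl _ _ _ _)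

  *-distribˡ-Σᶠ : ∀ {m} c (f : Fin m → Carrier) → Σᶠ (λ i → c * f i) ≡ c * Σᶠ f
  *-distribˡ-Σᶠ {zero} c f = sym (zeroʳ c)
  *-distribˡ-Σᶠ {suc m} c f =
    trans (cong (c * f zero +_) (*-distribˡ-Σᶠ c (λ i → f (suc i)))) (sym (distribˡ c _ _))

  *-distribʳ-Σᶠ : ∀ {m} c (f : Fin m → Carrier) → Σᶠ (λ i → f i * c) ≡ Σᶠ f * c
  *-distribʳ-Σᶠ c f = trans (Σᶠ-cong (λ i → *-comm (f i) c)) (trans (*-distribˡ-Σᶠ c f) (*-comm c _))

  neg-distrib-Σᶠ : ∀ {m} (f : Fin m → Carrier) → Σᶠ (λ i → - f i) ≡ - Σᶠ f
  neg-distrib-Σᶠ f = +-inverseˡ-unique _ _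
    (trans (sym (Σᶠ-distrib-+ (λ i → - f i) f)) (Σᶠ-zero (λ i → -‿inverseˡ (f i))))

  Σᶠ-comm : ∀ {m k} (f : Fin m → Fin k → Carrier) →
            Σᶠ (λ i → Σᶠ (λ j → f i j)) ≡ Σᶠ (λ j → Σᶠ (λ i → f i j))
  Σᶠ-comm {zero} {k} f = sym (Σᶠ-zero {k} (λ j → refl))
  Σᶠ-comm {suc m} f = trans (cong (Σᶠ (f zero) +_) (Σᶠ-comm (λ i → f (suc i))))
                            (sym (Σᶠ-distrib-+ (f zero) (λ j → Σᶠ (λ i → f (suc i) j))))

  Σᶠ-single : ∀ {m} (f : Fin m → Carrier) i → (∀ j → j ≢ i → f j ≡ 0#) → Σᶠ f ≡ f i
  Σᶠ-single {suc m} f zero f≗0 =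
    trans (cong (f zero +_) (Σᶠ-zero (λ j → f≗0 (suc j) λ ()))) (+-identityʳ _)
  Σᶠ-single {suc m} f (suc i) f≗0 =
    trans (cong₂ _+_ (f≗0 zero λ ()) (Σᶠ-single (λ j → f (suc j)) i (λ j j≢i → f≗0 (suc j) (j≢i ∘ suc-injective))))
          (+-identityˡ _)

  δ : ∀ {m} → Fin m → Fin m → Carrier
  δ i j with i ≟ j
  ... | yes _ = 1#
  ... | no _ = 0#

  δ-diag : ∀ {m} (i : Fin m) → δ i i ≡ 1#
  δ-diag i with i ≟ i
  ... | yes _ = refl
  ... | no i≢i = ⊥-elim (i≢i refl)

  δ-off : ∀ {m} {i j : Fin m} → i ≢ j → δ i j ≡ 0#
  δ-off {i = i} {j} i≢j with i ≟ j
  ... | yes i≡j = ⊥-elim (i≢j i≡j)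
  ... | no _ = refl

  Σᶠ-δ : ∀ {m} (i : Fin m) (f : Fin m → Carrier) → Σᶠ (λ j → δ i j * f j) ≡ f i
  Σᶠ-δ i f = trans (Σᶠ-single _ i (λ j j≢i → trans (cong (_* f j) (δ-off (j≢i ∘ sym))) (zeroˡ _)))
                   (trans (cong (_* f i) (δ-diag i)) (*-identityˡ _))

  Σᶠδ≡1 : ∀ {m} (i : Fin m) → Σᶠ (δ i) ≡ 1#
  Σᶠδ≡1 i = trans (Σᶠ-cong (λ j → sym (*-identityʳ (δ i j)))) (Σᶠ-δ i (λ _ → 1#))

  ∀⊎∃¬ : ∀ {m} {P : Fin m → Set} → (∀ i → Dec (P i)) → (∀ i → P i) ⊎ ∃ λ i → ¬ P i
  ∀⊎∃¬ P? with all? P?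
  ... | yes ∀P = inj₁ ∀P
  ... | no ¬∀P = inj₂ (¬∀⟶∃¬ _ _ P? ¬∀P)

  zero⊎nonzero : ∀ {m} (f : Fin m → Carrier) → (∀ i → f i ≡ 0#) ⊎ ∃ λ i → f i ≢ 0#
  zero⊎nonzero f = ∀⊎∃¬ (λ i → f i ≟ᶠ 0#)

module GaussianElimination (F : OrderedField) {d n : ℕ} (p : Fin n → Fin d → OrderedField.Carrier F) where
  open FiniteSums F p public
  open SubsetProperties

  combine : ∀ {N M} → (Fin N → Carrier) → (Fin N → Fin M → Carrier) → Fin M → Carrier
  combine μ w k = Σᶠ (λ i → μ i * w i k)

  ⟨_,_⟩ : ∀ {M} → (Fin M → Carrier) → (Fin M → Carrier) → Carrier
  ⟨ f , x ⟩ = Σᶠ (λ k → f k * x k)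

  combine-+δ : ∀ {N M} (μ : Fin N → Carrier) (w : Fin N → Fin M → Carrier) i₀ t k →
               combine (λ i → μ i + δ i₀ i * t) w k ≡ combine μ w k + t * w i₀ k
  combine-+δ μ w i₀ t k = begin
    Σᶠ (λ i → (μ i + δ i₀ i * t) * w i k)
      ≡⟨ Σᶠ-cong (λ i → solve 4 (λ m e t x → (m :+ e :* t) :* x := m :* x :+ e :* (t :* x))
                               refl (μ i) (δ i₀ i) t (w i k)) ⟩
    Σᶠ (λ i → μ i * w i k + δ i₀ i * (t * w i k))
      ≡⟨ Σᶠ-distrib-+ (λ i → μ i * w i k) (λ i → δ i₀ i * (t * w i k)) ⟩
    combine μ w k + Σᶠ (λ i → δ i₀ i * (t * w i k))
      ≡⟨ cong (combine μ w k +_) (Σᶠ-δ i₀ (λ i → t * w i k)) ⟩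
    combine μ w k + t * w i₀ k ∎
    where open ≡-Reasoning

  ⟨,⟩-distrib-sub : ∀ {M} (f a b : Fin M → Carrier) c →
                    ⟨ f , (λ k → a k + - (c * b k)) ⟩ ≡ ⟨ f , a ⟩ + - (c * ⟨ f , b ⟩)
  ⟨,⟩-distrib-sub f a b c = begin
    Σᶠ (λ k → f k * (a k + - (c * b k)))
      ≡⟨ Σᶠ-cong (λ k → solve 4 (λ f a c b → f :* (a :+ :- (c :* b)) := f :* a :+ :- (c :* (f :* b)))
                               refl (f k) (a k) c (b k)) ⟩
    Σᶠ (λ k → f k * a k + - (c * (f k * b k)))
      ≡⟨ Σᶠ-distrib-+ (λ k → f k * a k) (λ k → - (c * (f k * b k))) ⟩
    ⟨ f , a ⟩ + Σᶠ (λ k → - (c * (f k * b k)))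
      ≡⟨ cong (⟨ f , a ⟩ +_) (trans (neg-distrib-Σᶠ (λ k → c * (f k * b k)))
                                    (cong -_ (*-distribˡ-Σᶠ c (λ k → f k * b k)))) ⟩
    ⟨ f , a ⟩ + - (c * ⟨ f , b ⟩) ∎
    where open ≡-Reasoning

  module Pivot {N M} (w : Fin N → Fin M → Carrier) (i₀ : Fin N) (k₀ : Fin M) (pivot≢0 : w i₀ k₀ ≢ 0#) where
    q : Carrier
    q = w i₀ k₀ ⁻¹⟨ pivot≢0 ⟩

    reduce : (Fin M → Carrier) → Fin M → Carrier
    reduce x k = x k + - (x k₀ * q * w i₀ k)

    reduce-pivotColumn : ∀ x → reduce x k₀ ≡ 0#
    reduce-pivotColumn x = trans (cong (λ z → x k₀ + - z) (y*x⁻¹*x≡y (x k₀) pivot≢0)) (-‿inverseʳ (x k₀))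

    reduce-pivotRow : ∀ k → reduce (w i₀) k ≡ 0#
    reduce-pivotRow k = trans (cong (λ z → w i₀ k + - (z * w i₀ k)) (*-inverseʳ (w i₀ k₀) pivot≢0))
                              (trans (cong (λ z → w i₀ k + - z) (*-identityˡ (w i₀ k))) (-‿inverseʳ (w i₀ k)))

    unreduce : ∀ x k → x k ≡ reduce x k + x k₀ * q * w i₀ k
    unreduce x k = solve 2 (λ a b → a := a :+ :- b :+ b) refl (x k) (x k₀ * q * w i₀ k)

    combine-reduce : ∀ μ k → combine μ (λ i → reduce (w i)) k ≡ reduce (combine μ w) k
    combine-reduce μ k = begin
      Σᶠ (λ i → μ i * (w i k + - (w i k₀ * q * w i₀ k)))
        ≡⟨ Σᶠ-cong (λ i → solve 5 (λ m a b q c → m :* (a :+ :- (b :* q :* c)) := m :* a :+ :- (m :* b :* (q :* c)))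
                                   refl (μ i) (w i k) (w i k₀) q (w i₀ k)) ⟩
      Σᶠ (λ i → μ i * w i k + - (μ i * w i k₀ * (q * w i₀ k)))
        ≡⟨ Σᶠ-distrib-+ (λ i → μ i * w i k) (λ i → - (μ i * w i k₀ * (q * w i₀ k))) ⟩
      combine μ w k + Σᶠ (λ i → - (μ i * w i k₀ * (q * w i₀ k)))
        ≡⟨ cong (combine μ w k +_) (trans (neg-distrib-Σᶠ (λ i → μ i * w i k₀ * (q * w i₀ k)))
                                          (cong -_ (*-distribʳ-Σᶠ (q * w i₀ k) (λ i → μ i * w i k₀)))) ⟩
      combine μ w k + - (combine μ w k₀ * (q * w i₀ k))
        ≡⟨ cong (λ z → combine μ w k + - z) (sym (*-assoc _ q (w i₀ k))) ⟩
      reduce (combine μ w) k ∎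
      where open ≡-Reasoning

    reduceᵀ : (Fin M → Carrier) → Fin M → Carrier
    reduceᵀ f k = f k + - (δ k₀ k * (⟨ f , w i₀ ⟩ * q))

    ⟨reduceᵀ,⟩ : ∀ f x → ⟨ reduceᵀ f , x ⟩ ≡ ⟨ f , reduce x ⟩
    ⟨reduceᵀ,⟩ f x = begin
      Σᶠ (λ k → (f k + - (δ k₀ k * g)) * x k)
        ≡⟨ Σᶠ-cong (λ k → solve 4 (λ f e g x → (f :+ :- (e :* g)) :* x := f :* x :+ :- (e :* (g :* x)))
                                 refl (f k) (δ k₀ k) g (x k)) ⟩
      Σᶠ (λ k → f k * x k + - (δ k₀ k * (g * x k)))
        ≡⟨ Σᶠ-distrib-+ (λ k → f k * x k) (λ k → - (δ k₀ k * (g * x k))) ⟩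
      ⟨ f , x ⟩ + Σᶠ (λ k → - (δ k₀ k * (g * x k)))
        ≡⟨ cong (⟨ f , x ⟩ +_) (trans (neg-distrib-Σᶠ (λ k → δ k₀ k * (g * x k)))
                                      (cong -_ (Σᶠ-δ k₀ (λ k → g * x k)))) ⟩
      ⟨ f , x ⟩ + - (⟨ f , w i₀ ⟩ * q * x k₀)
        ≡⟨ cong (λ z → ⟨ f , x ⟩ + - z)
                (solve 3 (λ a q b → a :* q :* b := b :* q :* a) refl ⟨ f , w i₀ ⟩ q (x k₀)) ⟩
      ⟨ f , x ⟩ + - (x k₀ * q * ⟨ f , w i₀ ⟩)
        ≡⟨ sym (⟨,⟩-distrib-sub f x (w i₀) (x k₀ * q)) ⟩
      ⟨ f , reduce x ⟩ ∎
      where open ≡-Reasoning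
            g = ⟨ f , w i₀ ⟩ * q

  Supported : ∀ {N} → Subset N → (Fin N → Carrier) → Set
  Supported S μ = ∀ i → i ∉ S → μ i ≡ 0#

  Supported-+δ : ∀ {N} {S : Subset N} {i₀ μ} t → i₀ ∈ S → Supported (S - i₀) μ →
                 Supported S (λ i → μ i + δ i₀ i * t)
  Supported-+δ {i₀ = i₀} t i₀∈S μ∈S-i₀ i i∉S =
    trans (cong₂ _+_ (μ∈S-i₀ i (i∉S ∘ x∈p-y⇒x∈p))
                     (trans (cong (_* t) (δ-off {i = i₀} λ { refl → i∉S i₀∈S })) (zeroˡ t)))
          (+-identityˡ 0#)

  ⟨,⟩-zeroʳ : ∀ {M} (f x : Fin M → Carrier) → (∀ k → x k ≡ 0#) → ⟨ f , x ⟩ ≡ 0#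
  ⟨,⟩-zeroʳ f x x≗0 = Σᶠ-zero (λ k → trans (cong (f k *_) (x≗0 k)) (zeroʳ (f k)))

  Solvable : ∀ {N M} → Subset N → (Fin N → Fin M → Carrier) → (Fin M → Carrier) → Set
  Solvable S w y = ∃ λ μ → Supported S μ × (∀ k → combine μ w k ≡ y k)

  Separable : ∀ {N M} → Subset N → (Fin N → Fin M → Carrier) → (Fin M → Carrier) → Set
  Separable S w y = ∃ λ f → (∀ i → i ∈ S → ⟨ f , w i ⟩ ≡ 0#) × ⟨ f , y ⟩ ≢ 0#

  fredholm-alternative : ∀ {N M} s (S : Subset N) → ∣ S ∣ ≡ s →
                         (w : Fin N → Fin M → Carrier) (y : Fin M → Carrier) → Solvable S w y ⊎ Separable S w y
  fredholm-alternative zero S ∣S∣≡0 w y with zero⊎nonzero y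
  ... | inj₁ y≗0 = inj₁ ((λ _ → 0#) , (λ _ _ → refl) , λ k → trans (Σᶠ-zero (λ i → zeroˡ (w i k))) (sym (y≗0 k)))
  ... | inj₂ (k , yk≢0) =
    inj₂ (δ k , (λ i i∈S → ⊥-elim (∣p∣≡0⇒x∉p S ∣S∣≡0 i∈S)) , yk≢0 ∘ trans (sym (Σᶠ-δ k y)))
  fredholm-alternative (suc s) S ∣S∣≡1+s w y with ∣p∣≡1+s⇒nonempty S ∣S∣≡1+s
  ... | i₀ , i₀∈S with zero⊎nonzero (w i₀)
  ...   | inj₁ wi₀≗0 = Data.Sum.map weaken extend (fredholm-alternative s (S - i₀) ∣S-i₀∣≡s w y)
    where
    ∣S-i₀∣≡s = ∣p∣≡1+s⇒∣p-x∣≡s S i₀∈S ∣S∣≡1+s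
    weaken : Solvable (S - i₀) w y → Solvable S w y
    weaken (μ , μ∈S-i₀ , μw≗y) = μ , (λ i i∉S → μ∈S-i₀ i (i∉S ∘ x∈p-y⇒x∈p)) , μw≗y
    extend : Separable (S - i₀) w y → Separable S w y
    extend (f , f⊥S-i₀ , f⊥̸y) = f , f⊥S , f⊥̸y
      where
      f⊥S : ∀ i → i ∈ S → ⟨ f , w i ⟩ ≡ 0#
      f⊥S i i∈S with i ≟ i₀
      ... | yes refl = ⟨,⟩-zeroʳ f (w i₀) wi₀≗0
      ... | no i≢i₀ = f⊥S-i₀ i (x∈p∧x≢y⇒x∈p-y i∈S i≢i₀)
  ...   | inj₂ (k₀ , pivot≢0) =
    Data.Sum.map lift lift′ (fredholm-alternative s (S - i₀) ∣S-i₀∣≡s (λ i → reduce (w i)) (reduce y))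
    where
    open Pivot w i₀ k₀ pivot≢0
    ∣S-i₀∣≡s = ∣p∣≡1+s⇒∣p-x∣≡s S i₀∈S ∣S∣≡1+s
    lift : Solvable (S - i₀) (λ i → reduce (w i)) (reduce y) → Solvable S w y
    lift (μ , μ∈S-i₀ , μw≗y) = (λ i → μ i + δ i₀ i * t) , Supported-+δ t i₀∈S μ∈S-i₀ , solves
      where
      C = combine μ w k₀
      t = (y k₀ + - C) * q
      solves : ∀ k → combine (λ i → μ i + δ i₀ i * t) w k ≡ y k
      solves k = begin
        combine (λ i → μ i + δ i₀ i * t) w k           ≡⟨ combine-+δ μ w i₀ t k ⟩
        combine μ w k + t * b                          ≡⟨ cong (_+ t * b) (unreduce (combine μ w) k) ⟩
        reduce (combine μ w) k + C * q * b + t * b     ≡⟨ cong (λ z → z + C * q * b + t * b) (sym (combine-reduce μ k)) ⟩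
        combine μ (λ i → reduce (w i)) k + C * q * b + t * b ≡⟨ cong (λ z → z + C * q * b + t * b) (μw≗y k) ⟩
        y k + - (y k₀ * q * b) + C * q * b + t * b
          ≡⟨ solve 5 (λ y Y C q b → y :+ :- (Y :* q :* b) :+ C :* q :* b :+ (Y :+ :- C) :* q :* b := y)
                     refl (y k) (y k₀) C q b ⟩
        y k                                            ∎
        where open ≡-Reasoning
              b = w i₀ k
    lift′ : Separable (S - i₀) (λ i → reduce (w i)) (reduce y) → Separable S w y
    lift′ (f , f⊥S-i₀ , f⊥̸y) = reduceᵀ f , f⊥S , f⊥̸y ∘ trans (sym (⟨reduceᵀ,⟩ f y))
      where
      f⊥S : ∀ i → i ∈ S → ⟨ reduceᵀ f , w i ⟩ ≡ 0#
      f⊥S i i∈S with i ≟ i₀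
      ... | yes refl = trans (⟨reduceᵀ,⟩ f (w i₀)) (⟨,⟩-zeroʳ f (reduce (w i₀)) reduce-pivotRow)
      ... | no i≢i₀ = trans (⟨reduceᵀ,⟩ f (w i)) (f⊥S-i₀ i (x∈p∧x≢y⇒x∈p-y i∈S i≢i₀))

  Dependent : ∀ {N M} → Subset N → (Fin N → Fin M → Carrier) → Set
  Dependent S w = ∃ λ μ → Supported S μ × (∃ λ i → μ i ≢ 0#) × (∀ k → combine μ w k ≡ 0#)

  more-vectors-than-coordinates⇒Dependent :
    ∀ {N M} s (S : Subset N) (T : Subset M) (w : Fin N → Fin M → Carrier) → ∣ S ∣ ≡ s → ∣ T ∣ ℕ.< s →
    (∀ i k → i ∈ S → k ∉ T → w i k ≡ 0#) → Dependent S w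
  more-vectors-than-coordinates⇒Dependent (suc s) S T w ∣S∣≡1+s ∣T∣≤s w∈T
    with ∣p∣≡1+s⇒nonempty S ∣S∣≡1+s
  ... | i₀ , i₀∈S with zero⊎nonzero (w i₀)
  ...   | inj₁ wi₀≗0 = δ i₀ , (λ i i∉S → δ-off {i = i₀} λ { refl → i∉S i₀∈S }) ,
                       (i₀ , 0≢1 ∘ sym ∘ trans (sym (δ-diag i₀))) ,
                       λ k → trans (Σᶠ-δ i₀ (λ i → w i k)) (wi₀≗0 k)
  ...   | inj₂ (k₀ , pivot≢0) = lift (more-vectors-than-coordinates⇒Dependent s (S - i₀) (T - k₀)
                                       (λ i → reduce (w i)) ∣S-i₀∣≡s ∣T-k₀∣<s reduced∈T-k₀)
    where
    open Pivot w i₀ k₀ pivot≢0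
    ∣S-i₀∣≡s = ∣p∣≡1+s⇒∣p-x∣≡s S i₀∈S ∣S∣≡1+s
    k₀∈T : k₀ ∈ T
    k₀∈T with k₀ ∈? T
    ... | yes k₀∈T = k₀∈T
    ... | no k₀∉T = ⊥-elim (pivot≢0 (w∈T i₀ k₀ i₀∈S k₀∉T))
    ∣T-k₀∣<s : ∣ T - k₀ ∣ ℕ.< s
    ∣T-k₀∣<s = ℕ.≤-pred (subst (ℕ._< suc s) (∣p∣≡1+∣p-x∣ T k₀ k₀∈T) ∣T∣≤s)
    reduced∈T-k₀ : ∀ i k → i ∈ S - i₀ → k ∉ T - k₀ → reduce (w i) k ≡ 0#
    reduced∈T-k₀ i k i∈S-i₀ k∉T-k₀ with k ≟ k₀
    ... | yes refl = reduce-pivotColumn (w i)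
    ... | no k≢k₀ = begin
      w i k + - (w i k₀ * q * w i₀ k)   ≡⟨ cong₂ (λ a b → a + - (w i k₀ * q * b))
                                                 (w∈T i k (x∈p-y⇒x∈p i∈S-i₀) k∉T) (w∈T i₀ k i₀∈S k∉T) ⟩
      0# + - (w i k₀ * q * 0#)          ≡⟨ cong (λ z → 0# + - z) (zeroʳ (w i k₀ * q)) ⟩
      0# + - 0#                         ≡⟨ -‿inverseʳ 0# ⟩
      0#                                ∎
      where open ≡-Reasoning
            k∉T : k ∉ T
            k∉T k∈T = k∉T-k₀ (x∈p∧x≢y⇒x∈p-y k∈T k≢k₀)
    lift : Dependent (S - i₀) (λ i → reduce (w i)) → Dependent S w
    lift (μ , μ∈S-i₀ , (j , μj≢0) , μw≗0) =
      (λ i → μ i + δ i₀ i * t) , Supported-+δ t i₀∈S μ∈S-i₀ , (j , μj≢0 ∘ unchanged) , vanishes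
      where
      C = combine μ w k₀
      t = - (C * q)
      j≢i₀ : j ≢ i₀
      j≢i₀ refl = μj≢0 (μ∈S-i₀ j x∉p-x)
      unchanged : μ j + δ i₀ j * t ≡ 0# → μ j ≡ 0#
      unchanged = trans (sym (trans (cong (μ j +_) (trans (cong (_* t) (δ-off (j≢i₀ ∘ sym))) (zeroˡ t)))
                                    (+-identityʳ (μ j))))
      vanishes : ∀ k → combine (λ i → μ i + δ i₀ i * t) w k ≡ 0#
      vanishes k = begin
        combine (λ i → μ i + δ i₀ i * t) w k           ≡⟨ combine-+δ μ w i₀ t k ⟩
        combine μ w k + t * b                          ≡⟨ cong (_+ t * b) (unreduce (combine μ w) k) ⟩
        reduce (combine μ w) k + C * q * b + t * b     ≡⟨ cong (λ z → z + C * q * b + t * b) (sym (combine-reduce μ k)) ⟩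
        combine μ (λ i → reduce (w i)) k + C * q * b + t * b ≡⟨ cong (λ z → z + C * q * b + t * b) (μw≗0 k) ⟩
        0# + C * q * b + - (C * q) * b                 ≡⟨ solve 3 (λ z c b → z :+ c :* b :+ :- c :* b := z) refl 0# (C * q) b ⟩
        0#                                             ∎
        where open ≡-Reasoning
              b = w i₀ k

module AffineRank (F : OrderedField) {d n : ℕ} (p : Fin n → Fin d → OrderedField.Carrier F) where
  open GaussianElimination F p public
  open SubsetProperties

  OnHyperplane : Subset n → (Fin d → Carrier) → Carrier → Set
  OnHyperplane X a b = ∀ i → i ∈ X → a · p i ≡ b

  ·-comb : ∀ a μ → a · comb μ ≡ Σᶠ (λ i → μ i * (a · p i))
  ·-comb a μ = begin
    Σᶠ (λ k → a k * Σᶠ (λ i → μ i * p i k))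
      ≡⟨ Σᶠ-cong (λ k → sym (*-distribˡ-Σᶠ (a k) (λ i → μ i * p i k))) ⟩
    Σᶠ (λ k → Σᶠ (λ i → a k * (μ i * p i k)))
      ≡⟨ Σᶠ-comm (λ k i → a k * (μ i * p i k)) ⟩
    Σᶠ (λ i → Σᶠ (λ k → a k * (μ i * p i k)))
      ≡⟨ Σᶠ-cong (λ i → trans (Σᶠ-cong (λ k → swap (a k) (μ i) (p i k))) (*-distribˡ-Σᶠ (μ i) (λ k → a k * p i k))) ⟩
    Σᶠ (λ i → μ i * (a · p i)) ∎
    where open ≡-Reasoning
          swap = solve 3 (λ a m x → a :* (m :* x) := m :* (a :* x)) refl

  ·-zeroˡ : ∀ {a} x → (∀ k → a k ≡ 0#) → a · x ≡ 0#
  ·-zeroˡ x a≡0 = Σᶠ-zero λ k → trans (cong (_* x k) (a≡0 k)) (zeroˡ (x k))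

  neg-· : ∀ a x → (λ k → - a k) · x ≡ - (a · x)
  neg-· a x = trans (Σᶠ-cong (λ k → solve 2 (λ a x → :- a :* x := :- (a :* x)) refl (a k) (x k)))
                    (neg-distrib-Σᶠ (λ k → a k * x k))

  Σᶠ-cong-on : ∀ {X μ} (g h : Fin n → Carrier) → SupportedOn X μ → (∀ i → i ∈ X → g i ≡ h i) →
               Σᶠ (λ i → μ i * g i) ≡ Σᶠ (λ i → μ i * h i)
  Σᶠ-cong-on {X} {μ} g h μ∈X g≡h = Σᶠ-cong μg≡μh
    where
    μg≡μh : ∀ i → μ i * g i ≡ μ i * h i
    μg≡μh i with i ∈? X
    ... | yes i∈X = cong (μ i *_) (g≡h i i∈X)
    ... | no i∉X = trans (cong (_* g i) (μ∈X i i∉X)) (trans (zeroˡ _) (sym (trans (cong (_* h i) (μ∈X i i∉X)) (zeroˡ _))))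

  Σᶠ-*-const : ∀ {X μ} (g : Fin n → Carrier) b → SupportedOn X μ → (∀ i → i ∈ X → g i ≡ b) →
               Σᶠ (λ i → μ i * g i) ≡ Σᶠ μ * b
  Σᶠ-*-const {μ = μ} g b μ∈X g≡b = trans (Σᶠ-cong-on g (λ _ → b) μ∈X g≡b) (*-distribʳ-Σᶠ b μ)

  InAff-OnHyperplane : ∀ {X a b y} → OnHyperplane X a b → InAff X y → a · y ≡ b
  InAff-OnHyperplane {a = a} {b} X⊆H (μ , μ∈X , Σμ≡1 , μp≡y) = begin
    a · _                         ≡⟨ Σᶠ-cong (λ k → cong (a k *_) (sym (μp≡y k))) ⟩
    a · comb μ                    ≡⟨ ·-comb a μ ⟩
    Σᶠ (λ i → μ i * (a · p i))    ≡⟨ Σᶠ-*-const (λ i → a · p i) b μ∈X X⊆H ⟩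
    Σᶠ μ * b                      ≡⟨ cong (_* b) Σμ≡1 ⟩
    1# * b                        ≡⟨ *-identityˡ b ⟩
    b                             ∎
    where open ≡-Reasoning

  ∈⇒InAff : ∀ {X x} → x ∈ X → InAff X (p x)
  ∈⇒InAff {X} {x} x∈X = δ x , (λ i i∉X → δ-off {i = x} λ { refl → i∉X x∈X }) ,
                        Σᶠδ≡1 x , λ k → Σᶠ-δ x (λ i → p i k)

  InAff-mono : ∀ {X Y y} → X ⊆ Y → InAff X y → InAff Y y
  InAff-mono X⊆Y (μ , μ∈X , Σμ≡1 , μp≡y) = μ , (λ i i∉Y → μ∈X i (i∉Y ∘ X⊆Y)) , Σμ≡1 , μp≡y

  AffIndep-anti : ∀ {X Y} → X ⊆ Y → AffIndep Y → AffIndep X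
  AffIndep-anti X⊆Y indep μ μ∈X = indep μ (λ i i∉Y → μ∈X i (i∉Y ∘ X⊆Y))

  AffIndep-∅ : AffIndep ∅
  AffIndep-∅ μ μ∈∅ _ _ i = μ∈∅ i ∉⊥

  -- Points of F^d as vectors (1, x) of F^(d+1): affine combinations become linear ones.
  homogenise : (Fin d → Carrier) → Fin (suc d) → Carrier
  homogenise x zero = 1#
  homogenise x (suc k) = x k

  InAff⊎separated : ∀ A y → InAff A y ⊎ ∃ λ a → ∃ λ b → OnHyperplane A a b × a · y ≢ b
  InAff⊎separated A y with fredholm-alternative ∣ A ∣ A refl (λ i → homogenise (p i)) (homogenise y)
  ... | inj₁ (μ , μ∈A , μp≡y) =
    inj₁ (μ , μ∈A , trans (Σᶠ-cong (λ i → sym (*-identityʳ (μ i)))) (μp≡y zero) , μp≡y ∘ suc)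
  ... | inj₂ (f , f⊥A , f⊥̸y) =
    inj₂ (f ∘ suc , - (f zero * 1#) ,
          (λ i i∈A → +-inverseˡ-unique _ _ (trans (+-comm _ _) (f⊥A i i∈A))) ,
          λ fy≡ → f⊥̸y (trans (cong (f zero * 1# +_) fy≡) (-‿inverseʳ _)))

  ¬InAff-separated : ∀ {A a b y} → OnHyperplane A a b → a · y ≢ b → ¬ InAff A y
  ¬InAff-separated A⊆H ay≢b = ay≢b ∘ InAff-OnHyperplane A⊆H

  AffIndep-∪⁅⁆ : ∀ {A x} → AffIndep A → ¬ InAff A (p x) → AffIndep (A ∪ ⁅ x ⁆)
  AffIndep-∪⁅⁆ {A} {x} indep x∉aff μ μ∈A∪x Σμ≡0 μp≡0 with μ x ≟ᶠ 0#
  ... | yes μx≡0 = indep μ μ∈A Σμ≡0 μp≡0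
    where
    μ∈A : SupportedOn A μ
    μ∈A i i∉A with i ≟ x
    ... | yes refl = μx≡0
    ... | no i≢x = μ∈A∪x i (x∉p∧x≢y⇒x∉p∪⁅y⁆ i∉A i≢x)
  ... | no μx≢0 = ⊥-elim (x∉aff (ν , ν∈A , Σν≡1 , νp≡x))
    where
    -- ν expresses p x through A, by solving  μ x p x + Σ_{i ∈ A} μ i p i = 0  for p x
    c = - μ x ⁻¹⟨ μx≢0 ⟩
    ν : Fin n → Carrier
    ν i = μ i * c + δ x i
    νx≡0 : ν x ≡ 0#
    νx≡0 = begin
      μ x * - μ x ⁻¹⟨ μx≢0 ⟩ + δ x x   ≡⟨ cong₂ _+_ (solve 2 (λ m z → m :* :- z := :- (m :* z)) refl (μ x) _) (δ-diag x) ⟩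
      - (μ x * μ x ⁻¹⟨ μx≢0 ⟩) + 1#    ≡⟨ cong (λ z → - z + 1#) (*-inverseʳ (μ x) μx≢0) ⟩
      - 1# + 1#                        ≡⟨ -‿inverseˡ 1# ⟩
      0#                               ∎
      where open ≡-Reasoning
    ν∈A : SupportedOn A ν
    ν∈A i i∉A with i ≟ x
    ... | yes refl = νx≡0
    ... | no i≢x = trans (cong₂ _+_ (trans (cong (_* c) (μ∈A∪x i (x∉p∧x≢y⇒x∉p∪⁅y⁆ i∉A i≢x))) (zeroˡ c))
                                    (δ-off {i = x} (i≢x ∘ sym)))
                         (+-identityˡ 0#)
    Σν≡1 : Σᶠ ν ≡ 1#
    Σν≡1 = begin
      Σᶠ ν                           ≡⟨ Σᶠ-distrib-+ (λ i → μ i * c) (δ x) ⟩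
      Σᶠ (λ i → μ i * c) + Σᶠ (δ x)  ≡⟨ cong₂ _+_ (*-distribʳ-Σᶠ c μ) (Σᶠδ≡1 x) ⟩
      Σᶠ μ * c + 1#                  ≡⟨ cong (λ z → z * c + 1#) Σμ≡0 ⟩
      0# * c + 1#                    ≡⟨ cong (_+ 1#) (zeroˡ c) ⟩
      0# + 1#                        ≡⟨ +-identityˡ 1# ⟩
      1#                             ∎
      where open ≡-Reasoning
    νp≡x : ∀ k → comb ν k ≡ p x k
    νp≡x k = begin
      Σᶠ (λ i → (μ i * c + δ x i) * p i k)
        ≡⟨ Σᶠ-cong (λ i → solve 4 (λ m c e z → (m :* c :+ e) :* z := c :* (m :* z) :+ e :* z)
                                 refl (μ i) c (δ x i) (p i k)) ⟩
      Σᶠ (λ i → c * (μ i * p i k) + δ x i * p i k)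
        ≡⟨ Σᶠ-distrib-+ (λ i → c * (μ i * p i k)) (λ i → δ x i * p i k) ⟩
      Σᶠ (λ i → c * (μ i * p i k)) + Σᶠ (λ i → δ x i * p i k)
        ≡⟨ cong₂ _+_ (trans (*-distribˡ-Σᶠ c (λ i → μ i * p i k)) (trans (cong (c *_) (μp≡0 k)) (zeroʳ c)))
                     (Σᶠ-δ x (λ i → p i k)) ⟩
      0# + p x k
        ≡⟨ +-identityˡ (p x k) ⟩
      p x k ∎
      where open ≡-Reasoning

  steinitz-exchange : ∀ A A′ → (∀ x → x ∈ A′ → InAff A (p x)) → AffIndep A′ → ∣ A′ ∣ ℕ.≤ ∣ A ∣
  steinitz-exchange A A′ A′⊆aff indep with ∣ A′ ∣ ℕ.≤? ∣ A ∣
  ... | yes ∣A′∣≤∣A∣ = ∣A′∣≤∣A∣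
  ... | no ∣A′∣≰∣A∣ = ⊥-elim (contradiction (more-vectors-than-coordinates⇒Dependent
                                               ∣ A′ ∣ A′ A α refl (ℕ.≰⇒> ∣A′∣≰∣A∣) (λ i k _ → α∈A i k)))
    where
    coefficients : ∀ i → ∃ λ α → SupportedOn A α × (i ∈ A′ → Σᶠ α ≡ 1# × (∀ k → comb α k ≡ p i k))
    coefficients i with i ∈? A′
    ... | yes i∈A′ = let (α , α∈A , Σα≡1 , αp≡pi) = A′⊆aff i i∈A′ in α , α∈A , λ _ → Σα≡1 , αp≡pi
    ... | no i∉A′ = (λ _ → 0#) , (λ _ _ → refl) , λ i∈A′ → ⊥-elim (i∉A′ i∈A′)
    α : Fin n → Fin n → Carrier
    α i = proj₁ (coefficients i)
    α∈A : ∀ i → SupportedOn A (α i)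
    α∈A i = proj₁ (proj₂ (coefficients i))
    Σα≡1 : ∀ i → i ∈ A′ → Σᶠ (α i) ≡ 1#
    Σα≡1 i i∈A′ = proj₁ (proj₂ (proj₂ (coefficients i)) i∈A′)
    αp≡p : ∀ i → i ∈ A′ → ∀ k → comb (α i) k ≡ p i k
    αp≡p i i∈A′ = proj₂ (proj₂ (proj₂ (coefficients i)) i∈A′)
    contradiction : Dependent A′ α → ⊥
    contradiction (μ , μ∈A′ , (j , μj≢0) , μα≡0) = μj≢0 (indep μ μ∈A′ Σμ≡0 μp≡0 j)
      where
      Σμ≡0 : Σᶠ μ ≡ 0#
      Σμ≡0 = begin
        Σᶠ μ
          ≡⟨ Σᶠ-cong (λ i → sym (*-identityʳ (μ i))) ⟩
        Σᶠ (λ i → μ i * 1#)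
          ≡⟨ Σᶠ-cong-on (λ _ → 1#) (λ i → Σᶠ (α i)) μ∈A′ (λ i i∈A′ → sym (Σα≡1 i i∈A′)) ⟩
        Σᶠ (λ i → μ i * Σᶠ (α i))
          ≡⟨ Σᶠ-cong (λ i → sym (*-distribˡ-Σᶠ (μ i) (α i))) ⟩
        Σᶠ (λ i → Σᶠ (λ k → μ i * α i k))
          ≡⟨ Σᶠ-comm (λ i k → μ i * α i k) ⟩
        Σᶠ (λ k → combine μ α k)
          ≡⟨ Σᶠ-zero μα≡0 ⟩
        0# ∎
        where open ≡-Reasoning
      μp≡0 : ∀ t → comb μ t ≡ 0#
      μp≡0 t = begin
        Σᶠ (λ i → μ i * p i t)
          ≡⟨ Σᶠ-cong-on (λ i → p i t) (λ i → comb (α i) t) μ∈A′ (λ i i∈A′ → sym (αp≡p i i∈A′ t)) ⟩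
        Σᶠ (λ i → μ i * Σᶠ (λ k → α i k * p k t))
          ≡⟨ Σᶠ-cong (λ i → sym (*-distribˡ-Σᶠ (μ i) (λ k → α i k * p k t))) ⟩
        Σᶠ (λ i → Σᶠ (λ k → μ i * (α i k * p k t)))
          ≡⟨ Σᶠ-comm (λ i k → μ i * (α i k * p k t)) ⟩
        Σᶠ (λ k → Σᶠ (λ i → μ i * (α i k * p k t)))
          ≡⟨ Σᶠ-cong (λ k → trans (Σᶠ-cong (λ i → sym (*-assoc (μ i) (α i k) (p k t))))
                                  (*-distribʳ-Σᶠ (p k t) (λ i → μ i * α i k))) ⟩
        Σᶠ (λ k → combine μ α k * p k t)
          ≡⟨ Σᶠ-zero (λ k → trans (cong (_* p k t) (μα≡0 k)) (zeroˡ _)) ⟩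
        0# ∎
        where open ≡-Reasoning

  AffineBasis : Subset n → Subset n → Set
  AffineBasis X A = A ⊆ X × AffIndep A × (∀ x → x ∈ X → InAff A (p x))

  affineBasis : ∀ X → ∃ (AffineBasis X)
  affineBasis X = let (A , A⊆X , indep , X⊆aff) = grow (allFin n) in A , A⊆X , indep , λ x x∈X → X⊆aff x x∈X (∈-allFin x)
    where
    grow : ∀ xs → ∃ λ A → A ⊆ X × AffIndep A × (∀ x → x ∈ X → x List.∈ xs → InAff A (p x))
    grow [] = ∅ , (λ x∈∅ → ⊥-elim (∉⊥ x∈∅)) , AffIndep-∅ , λ _ _ ()
    grow (x ∷ xs) with grow xs | x ∈? X
    ... | A , A⊆X , indep , covers | no x∉X = A , A⊆X , indep , covers′
      where
      covers′ : ∀ y → y ∈ X → y List.∈ x ∷ xs → InAff A (p y)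
      covers′ y y∈X (here refl) = ⊥-elim (x∉X y∈X)
      covers′ y y∈X (there y∈xs) = covers y y∈X y∈xs
    ... | A , A⊆X , indep , covers | yes x∈X with InAff⊎separated A (p x)
    ...   | inj₁ x∈aff = A , A⊆X , indep , covers′
      where
      covers′ : ∀ y → y ∈ X → y List.∈ x ∷ xs → InAff A (p y)
      covers′ y y∈X (here refl) = x∈aff
      covers′ y y∈X (there y∈xs) = covers y y∈X y∈xs
    ...   | inj₂ (a , b , A⊆H , ax≢b) =
      A ∪ ⁅ x ⁆ , A∪x⊆X , AffIndep-∪⁅⁆ indep (¬InAff-separated A⊆H ax≢b) , covers′
      where
      A∪x⊆X : A ∪ ⁅ x ⁆ ⊆ X
      A∪x⊆X = ∪⁅⁆-⊆ A⊆X x∈X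
      covers′ : ∀ y → y ∈ X → y List.∈ x ∷ xs → InAff (A ∪ ⁅ x ⁆) (p y)
      covers′ y y∈X (here refl) = ∈⇒InAff (y∈p∪⁅y⁆ A x)
      covers′ y y∈X (there y∈xs) = InAff-mono (λ z∈A → x∈p∪q⁺ (inj₁ z∈A)) (covers y y∈X y∈xs)

  AffineBasis⇒AffRank : ∀ {X A} → AffineBasis X A → AffRank X ∣ A ∣
  AffineBasis⇒AffRank {X} {A} (A⊆X , indep , X⊆aff) =
    (A , A⊆X , indep , refl) ,
    λ A′ A′⊆X indep′ → steinitz-exchange A A′ (λ x x∈A′ → X⊆aff x (A′⊆X x∈A′)) indep′

  AffRank-exists : ∀ X → ∃ (AffRank X)
  AffRank-exists X = let (A , basis) = affineBasis X in ∣ A ∣ , AffineBasis⇒AffRank basis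

  AffRank-unique : ∀ {X r s} → AffRank X r → AffRank X s → r ≡ s
  AffRank-unique ((A , A⊆X , indepA , ∣A∣≡r) , maxʳ) ((B , B⊆X , indepB , ∣B∣≡s) , maxˢ) =
    ℕ.≤-antisym (subst (ℕ._≤ _) ∣A∣≡r (maxˢ A A⊆X indepA)) (subst (ℕ._≤ _) ∣B∣≡s (maxʳ B B⊆X indepB))

  AffRank-mono : ∀ {X Y r s} → X ⊆ Y → AffRank X r → AffRank Y s → r ℕ.≤ s
  AffRank-mono X⊆Y ((A , A⊆X , indep , ∣A∣≡r) , _) (_ , max) = subst (ℕ._≤ _) ∣A∣≡r (max A (X⊆Y ∘ A⊆X) indep)

  AffRank-∪⁅⁆ : ∀ {X r x} → AffRank X r → ¬ InAff X (p x) → AffRank (X ∪ ⁅ x ⁆) (suc r)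
  AffRank-∪⁅⁆ {X} {r} {x} ((A , A⊆X , indep , ∣A∣≡r) , max) x∉aff =
    (A ∪ ⁅ x ⁆ , A∪x⊆X∪x , AffIndep-∪⁅⁆ indep x∉affA , ∣A∪x∣≡1+r) , max′
    where
    x∉affA : ¬ InAff A (p x)
    x∉affA = x∉aff ∘ InAff-mono A⊆X
    A∪x⊆X∪x : A ∪ ⁅ x ⁆ ⊆ X ∪ ⁅ x ⁆
    A∪x⊆X∪x = ∪⁅⁆-monoˡ A⊆X
    ∣A∪x∣≡1+r : ∣ A ∪ ⁅ x ⁆ ∣ ≡ suc r
    ∣A∪x∣≡1+r = trans (∣p∪⁅x⁆∣≡1+∣p∣ A x (x∉affA ∘ ∈⇒InAff)) (cong suc ∣A∣≡r)
    max′ : ∀ B → B ⊆ X ∪ ⁅ x ⁆ → AffIndep B → ∣ B ∣ ℕ.≤ suc r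
    max′ B B⊆X∪x indepB = ℕ.≤-trans ∣B∣≤1+∣B-x∣ (ℕ.s≤s (max (B - x) B-x⊆X (AffIndep-anti x∈p-y⇒x∈p indepB)))
      where
      B-x⊆X : B - x ⊆ X
      B-x⊆X y∈ = x∈p∪⁅y⁆∧x≢y⇒x∈p (B⊆X∪x (x∈p-y⇒x∈p y∈)) (x∈p-y⇒x≢y y∈)
      ∣B∣≤1+∣B-x∣ : ∣ B ∣ ℕ.≤ suc ∣ B - x ∣
      ∣B∣≤1+∣B-x∣ with x ∈? B
      ... | yes x∈B = ℕ.≤-reflexive (∣p∣≡1+∣p-x∣ B x x∈B)
      ... | no x∉B = ℕ.m≤n⇒m≤1+n (p⊆q⇒∣p∣≤∣q∣ {p = B} {q = B - x} λ y∈B → x∈p∧x≢y⇒x∈p-y y∈B λ { refl → x∉B y∈B })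

module Faces (F : OrderedField) {d n : ℕ} (p : Fin n → Fin d → OrderedField.Carrier F) where
  open AffineRank F p public
  open SubsetProperties
  open Equivalence using (to; from)

  ¬InAff-∅ : ∀ {G y} → (∀ i → i ∉ G) → ¬ InAff G y
  ¬InAff-∅ G≡∅ (μ , μ∈G , Σμ≡1 , _) = 0≢1 (trans (sym (Σᶠ-zero (λ i → μ∈G i (G≡∅ i)))) Σμ≡1)

  Face⇒⊆ : ∀ {X G} → Face X G → G ⊆ X
  Face⇒⊆ (inj₁ G≡∅) {i} i∈G = ⊥-elim (G≡∅ i i∈G)
  Face⇒⊆ (inj₂ (a , b , _ , _ , G≡X∩H)) {i} i∈G = proj₁ (to (G≡X∩H i) i∈G)

  Facet⇒⊆ : ∀ {X G} → Facet X G → G ⊆ X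
  Facet⇒⊆ (G-face , _) = Face⇒⊆ G-face

  Face-∉⇒¬InAff : ∀ {X G x} → Face X G → x ∈ X → x ∉ G → ¬ InAff G (p x)
  Face-∉⇒¬InAff (inj₁ G≡∅) _ _ = ¬InAff-∅ G≡∅
  Face-∉⇒¬InAff {x = x} (inj₂ (a , b , _ , _ , G≡X∩H)) x∈X x∉G =
    ¬InAff-separated (λ i i∈G → proj₂ (to (G≡X∩H i) i∈G)) (λ ax≡b → x∉G (from (G≡X∩H x) (x∈X , ax≡b)))

  strictly-below : ∀ {Y a b u} → (∀ i → i ∈ Y → a · p i ≤ b) → InAff Y (p u) → b < a · p u →
                   ∃ λ i → i ∈ Y × a · p i < b
  strictly-below {Y} {a} {b} Y≤b u∈aff b<au with ∀⊎∃¬ (λ i → i ∈? Y →-dec (a · p i ≟ᶠ b))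
  ... | inj₁ Y⊆H = ⊥-elim (<⇒≢ b<au (sym (InAff-OnHyperplane Y⊆H u∈aff)))
  ... | inj₂ (i , i∉H) with i ∈? Y
  ...   | yes i∈Y = i , i∈Y , ≤∧≢⇒< (Y≤b i i∈Y) (λ ai≡b → i∉H (λ _ → ai≡b))
  ...   | no i∉Y = ⊥-elim (i∉H (λ i∈Y → ⊥-elim (i∉Y i∈Y)))

module ApexSeparation (F : OrderedField) {d n : ℕ} (p : Fin n → Fin d → OrderedField.Carrier F) (v : Fin n) where
  open Faces F p public
  open SubsetProperties

  ApexSeparator : Set
  ApexSeparator = ∃ λ h → ∃ λ c → (∀ i → i ≢ v → h · p i ≡ c) × h · p v < c

  apexSeparator : AffRank ⊤ (suc d) → AffRank (⊤ - v) d → ApexSeparator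
  apexSeparator ((A , _ , indepA , ∣A∣≡1+d) , _) rank-base with affineBasis (⊤ - v)
  ... | A₀ , basis@(_ , _ , base⊆aff) with InAff⊎separated A₀ (p v)
  ...   | inj₁ v∈aff = ⊥-elim (ℕ.<-irrefl refl (begin-strict
      d            <⟨ ℕ.n<1+n d ⟩
      suc d        ≡⟨ sym ∣A∣≡1+d ⟩
      ∣ A ∣        ≤⟨ steinitz-exchange A₀ A (λ x _ → all⊆aff x) indepA ⟩
      ∣ A₀ ∣       ≡⟨ AffRank-unique (AffineBasis⇒AffRank basis) rank-base ⟩
      d            ∎))
    where
    open ℕ.≤-Reasoning
    all⊆aff : ∀ x → InAff A₀ (p x)
    all⊆aff x with x ≟ v
    ... | yes refl = v∈aff
    ... | no x≢v = base⊆aff x (x∈p∧x≢y⇒x∈p-y ∈⊤ x≢v)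
  ...   | inj₂ (a , b , A₀⊆H , av≢b) = orient (<-tri (a · p v) b)
    where
    base⊆H : ∀ i → i ≢ v → a · p i ≡ b
    base⊆H i i≢v = InAff-OnHyperplane A₀⊆H (base⊆aff i (x∈p∧x≢y⇒x∈p-y ∈⊤ i≢v))
    orient : a · p v < b ⊎ a · p v ≡ b ⊎ b < a · p v → ApexSeparator
    orient (inj₁ av<b) = a , b , base⊆H , av<b
    orient (inj₂ (inj₁ av≡b)) = ⊥-elim (av≢b av≡b)
    orient (inj₂ (inj₂ b<av)) = (λ k → - a k) , - b ,
                                (λ i i≢v → trans (neg-· a (p i)) (cong -_ (base⊆H i i≢v))) ,
                                subst (_< - b) (sym (neg-· a (p v))) (neg-mono-< b<av)

module Pyramid (F : OrderedField) {d n : ℕ} (p : Fin n → Fin d → OrderedField.Carrier F) (v : Fin n)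
               (h : Fin d → OrderedField.Carrier F) (c : OrderedField.Carrier F)
               (base⊆H : ∀ i → i ≢ v → Geometry._·_ F p h (p i) ≡ c)
               (apex<c : OrderedField._<_ F (Geometry._·_ F p h (p v)) c) where
  open Faces F p public
  open SubsetProperties
  open Equivalence using (to; from)

  v∉⇒≢v : ∀ {B i} → v ∉ B → i ∈ B → i ≢ v
  v∉⇒≢v v∉B i∈B refl = v∉B i∈B

  apex∉aff : ∀ {X} → v ∉ X → ¬ InAff X (p v)
  apex∉aff v∉X = <⇒≢ apex<c ∘ InAff-OnHyperplane (λ i i∈X → base⊆H i (v∉⇒≢v v∉X i∈X))

  AffRank-cone : ∀ {B r} → v ∉ B → AffRank B r → AffRank (B ∪ ⁅ v ⁆) (suc r)
  AffRank-cone v∉B rank = AffRank-∪⁅⁆ rank (apex∉aff v∉B)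

  AffRank-cone⁻¹ : ∀ {B r} → v ∉ B → AffRank (B ∪ ⁅ v ⁆) (suc r) → AffRank B r
  AffRank-cone⁻¹ {B} v∉B rank with AffRank-exists B
  ... | s , rankB = subst (AffRank B) (ℕ.suc-injective (AffRank-unique (AffRank-cone v∉B rankB) rank)) rankB

  DropsDim-apex : ∀ {B} → v ∉ B → DropsDim (B ∪ ⁅ v ⁆) v
  DropsDim-apex {B} v∉B with AffRank-exists B
  ... | r , rankB = r , AffRank-cone v∉B rankB , subst (λ X → AffRank X r) (sym (p∪⁅x⁆-x≡p v∉B)) rankB

  DropsDim-cone : ∀ {B u} → v ∉ B → u ≢ v → DropsDim (B ∪ ⁅ v ⁆) u ⇔ DropsDim B u
  DropsDim-cone {B} {u} v∉B u≢v = mk⇔ to′ from′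
    where
    cone-u : ∀ {s} → AffRank (B - u) s → AffRank ((B ∪ ⁅ v ⁆) - u) (suc s)
    cone-u rank = subst (λ X → AffRank X _) (sym (p∪⁅x⁆-y≡p-y∪⁅x⁆ u≢v))
                        (AffRank-cone (v∉B ∘ x∈p-y⇒x∈p) rank)
    to′ : DropsDim (B ∪ ⁅ v ⁆) u → DropsDim B u
    to′ (r , rank , rank-u) with AffRank-exists (B - u)
    ... | s , rankB-u = s , subst (AffRank B) (AffRank-unique rank-u (cone-u rankB-u)) (AffRank-cone⁻¹ v∉B rank) , rankB-u
    from′ : DropsDim B u → DropsDim (B ∪ ⁅ v ⁆) u
    from′ (s , rankB , rankB-u) = suc s , AffRank-cone v∉B rankB , cone-u rankB-u

  hv-c≢0 : h · p v + - c ≢ 0#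
  hv-c≢0 = <⇒≢ apex<c ∘ x∙y⁻¹≈ε⇒x≈y _ _

  -- Evaluating h · x - c on the combination kills every base term, so the apex coefficient vanishes.
  InAff-cone⁻¹ : ∀ {Y u} → u ≢ v → InAff (Y ∪ ⁅ v ⁆) (p u) → InAff Y (p u)
  InAff-cone⁻¹ {Y} {u} u≢v (μ , μ∈Y∪v , Σμ≡1 , μp≡u) = μ , μ∈Y , Σμ≡1 , μp≡u
    where
    excess : Σᶠ (λ i → μ i * (h · p i + - c)) ≡ 0#
    excess = begin
      Σᶠ (λ i → μ i * (h · p i + - c))
        ≡⟨ Σᶠ-cong (λ i → solve 3 (λ m a c → m :* (a :+ :- c) := m :* a :+ :- (m :* c)) refl (μ i) (h · p i) c) ⟩
      Σᶠ (λ i → μ i * (h · p i) + - (μ i * c))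
        ≡⟨ Σᶠ-distrib-+ (λ i → μ i * (h · p i)) (λ i → - (μ i * c)) ⟩
      Σᶠ (λ i → μ i * (h · p i)) + Σᶠ (λ i → - (μ i * c))
        ≡⟨ cong₂ _+_ (sym (·-comb h μ)) (trans (neg-distrib-Σᶠ (λ i → μ i * c)) (cong -_ (*-distribʳ-Σᶠ c μ))) ⟩
      h · comb μ + - (Σᶠ μ * c)
        ≡⟨ cong₂ (λ x y → x + - (y * c)) (Σᶠ-cong (λ k → cong (h k *_) (μp≡u k))) Σμ≡1 ⟩
      h · p u + - (1# * c)
        ≡⟨ cong₂ (λ x y → x + - y) (base⊆H u u≢v) (*-identityˡ c) ⟩
      c + - c
        ≡⟨ -‿inverseʳ c ⟩
      0# ∎
      where open ≡-Reasoning
    only-apex : ∀ j → j ≢ v → μ j * (h · p j + - c) ≡ 0#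
    only-apex j j≢v with j ∈? Y
    ... | yes j∈Y = trans (cong (λ x → μ j * (x + - c)) (base⊆H j j≢v)) (trans (cong (μ j *_) (-‿inverseʳ c)) (zeroʳ (μ j)))
    ... | no j∉Y = trans (cong (_* _) (μ∈Y∪v j (x∉p∧x≢y⇒x∉p∪⁅y⁆ j∉Y j≢v))) (zeroˡ _)
    μv≡0 : μ v ≡ 0#
    μv≡0 = x*y≡0⇒y≡0 hv-c≢0 (trans (*-comm _ (μ v)) (trans (sym (Σᶠ-single _ v only-apex)) excess))
    μ∈Y : SupportedOn Y μ
    μ∈Y i i∉Y with i ≟ v
    ... | yes refl = μv≡0
    ... | no i≢v = μ∈Y∪v i (x∉p∧x≢y⇒x∉p∪⁅y⁆ i∉Y i≢v)

  facet-avoiding-apex : ∀ {B G} → v ∉ B → Facet (B ∪ ⁅ v ⁆) G → v ∉ G → G ≡ B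
  facet-avoiding-apex {B} {G} v∉B (G-face , r , rankB∪v , rankG) v∉G = ⊆-antisym G⊆B B⊆G
    where
    G⊆B : G ⊆ B
    G⊆B i∈G = x∈p∪⁅y⁆∧x≢y⇒x∈p (Face⇒⊆ G-face i∈G) (v∉⇒≢v v∉G i∈G)
    -- a point of B outside G would make G ∪ {x, v} a subset of B ∪ {v} of larger rank
    B⊆G : B ⊆ G
    B⊆G {x} x∈B with x ∈? G
    ... | yes x∈G = x∈G
    ... | no x∉G = ⊥-elim (ℕ.<-irrefl refl (AffRank-mono G∪x∪v⊆B∪v rankG∪x∪v rankB∪v))
      where
      rankG∪x∪v : AffRank ((G ∪ ⁅ x ⁆) ∪ ⁅ v ⁆) (suc (suc r))
      rankG∪x∪v = AffRank-cone (x∉p∧x≢y⇒x∉p∪⁅y⁆ v∉G (v∉⇒≢v v∉B x∈B ∘ sym))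
                               (AffRank-∪⁅⁆ rankG (Face-∉⇒¬InAff G-face (x∈p∪q⁺ (inj₁ x∈B)) x∉G))
      G∪x∪v⊆B∪v : (G ∪ ⁅ x ⁆) ∪ ⁅ v ⁆ ⊆ B ∪ ⁅ v ⁆
      G∪x∪v⊆B∪v = ∪⁅⁆-monoˡ (∪⁅⁆-⊆ G⊆B x∈B)

  base-facet : ∀ {B} → v ∉ B → Facet (B ∪ ⁅ v ⁆) B
  base-facet {B} v∉B with AffRank-exists B
  ... | r , rankB = B-face (nonempty? B) , r , AffRank-cone v∉B rankB , rankB
    where
    B-face : Dec (∃ λ i → i ∈ B) → Face (B ∪ ⁅ v ⁆) B
    B-face (no B≡∅) = inj₁ (λ i i∈B → B≡∅ (i , i∈B))
    B-face (yes (i , i∈B)) = inj₂ (h , c , h≢0 , B∪v≤c , λ j → mk⇔ (to′ j) (from′ j))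
      where
      h≢0 : ∃ λ k → h k ≢ 0#
      h≢0 with zero⊎nonzero h
      ... | inj₂ h≢0 = h≢0
      ... | inj₁ h≡0 = ⊥-elim (<⇒≢ apex<c (trans (·-zeroˡ (p v) h≡0)
                                              (trans (sym (·-zeroˡ (p i) h≡0)) (base⊆H i (v∉⇒≢v v∉B i∈B)))))
      B∪v≤c : ∀ j → j ∈ B ∪ ⁅ v ⁆ → h · p j ≤ c
      B∪v≤c j j∈ with j ≟ v
      ... | yes refl = inj₁ apex<c
      ... | no j≢v = inj₂ (base⊆H j j≢v)
      to′ : ∀ j → j ∈ B → j ∈ B ∪ ⁅ v ⁆ × h · p j ≡ c
      to′ j j∈B = x∈p∪q⁺ (inj₁ j∈B) , base⊆H j (v∉⇒≢v v∉B j∈B)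
      from′ : ∀ j → j ∈ B ∪ ⁅ v ⁆ × h · p j ≡ c → j ∈ B
      from′ j (j∈ , hj≡c) with j ≟ v
      ... | yes refl = ⊥-elim (<⇒≢ apex<c hj≡c)
      ... | no j≢v = x∈p∪⁅y⁆∧x≢y⇒x∈p j∈ j≢v

  facet-through-apex : ∀ {B G} → v ∉ B → Facet (B ∪ ⁅ v ⁆) G → v ∈ G → Facet B (G - v)
  facet-through-apex {B} {G} v∉B (G-face , r , rankB∪v , rankG) v∈G with AffRank-exists (G - v)
  ... | s , rankG-v = face G-face , s , subst (AffRank B) r≡1+s (AffRank-cone⁻¹ v∉B rankB∪v) , rankG-v
    where
    r≡1+s : r ≡ suc s
    r≡1+s = AffRank-unique rankG (subst (λ X → AffRank X (suc s)) (p-x∪⁅x⁆≡p v∈G) (AffRank-cone x∉p-x rankG-v))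
    face : Face (B ∪ ⁅ v ⁆) G → Face B (G - v)
    face (inj₁ G≡∅) = ⊥-elim (G≡∅ v v∈G)
    face (inj₂ (a , b , a≢0 , B∪v≤b , G≡B∪v∩H)) =
      inj₂ (a , b , a≢0 , (λ i i∈B → B∪v≤b i (x∈p∪q⁺ (inj₁ i∈B))) , λ i → mk⇔ (to′ i) (from′ i))
      where
      to′ : ∀ i → i ∈ G - v → i ∈ B × a · p i ≡ b
      to′ i i∈G-v = let (i∈B∪v , ai≡b) = to (G≡B∪v∩H i) (x∈p-y⇒x∈p i∈G-v) in
                    x∈p∪⁅y⁆∧x≢y⇒x∈p i∈B∪v (x∈p-y⇒x≢y i∈G-v) , ai≡b
      from′ : ∀ i → i ∈ B × a · p i ≡ b → i ∈ G - v
      from′ i (i∈B , ai≡b) =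
        x∈p∧x≢y⇒x∈p-y (from (G≡B∪v∩H i) (x∈p∪q⁺ (inj₁ i∈B) , ai≡b)) (v∉⇒≢v v∉B i∈B)

  -- Adding t · (h, c) to an affine functional (a, b) shifts all its values on the base by the
  -- same amount t c, and t is chosen so that the new hyperplane passes through the apex.
  module Tilt (a : Fin d → Carrier) (b : Carrier) where
    t : Carrier
    t = (b + - (a · p v)) * (h · p v + - c) ⁻¹⟨ hv-c≢0 ⟩

    a′ : Fin d → Carrier
    a′ k = a k + t * h k

    b′ : Carrier
    b′ = b + t * c

    ·-tilt : ∀ x → a′ · x ≡ a · x + t * (h · x)
    ·-tilt x = begin
      Σᶠ (λ k → (a k + t * h k) * x k)
        ≡⟨ Σᶠ-cong (λ k → solve 4 (λ a t h x → (a :+ t :* h) :* x := a :* x :+ t :* (h :* x)) refl (a k) t (h k) (x k)) ⟩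
      Σᶠ (λ k → a k * x k + t * (h k * x k))
        ≡⟨ Σᶠ-distrib-+ (λ k → a k * x k) (λ k → t * (h k * x k)) ⟩
      a · x + Σᶠ (λ k → t * (h k * x k))
        ≡⟨ cong (a · x +_) (*-distribˡ-Σᶠ t (λ k → h k * x k)) ⟩
      a · x + t * (h · x) ∎
      where open ≡-Reasoning

    tilt-base : ∀ i → i ≢ v → a′ · p i ≡ a · p i + t * c
    tilt-base i i≢v = trans (·-tilt (p i)) (cong (λ z → a · p i + t * z) (base⊆H i i≢v))

    tilt-apex : a′ · p v ≡ b′
    tilt-apex = begin
      a′ · p v                              ≡⟨ ·-tilt (p v) ⟩
      a · p v + t * (h · p v)               ≡⟨ solve 4 (λ A t H c → A :+ t :* H := A :+ t :* (H :+ :- c) :+ t :* c)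
                                                       refl (a · p v) t (h · p v) c ⟩
      a · p v + t * E + t * c               ≡⟨ cong (λ z → a · p v + z + t * c) (y*x⁻¹*x≡y (b + - (a · p v)) hv-c≢0) ⟩
      a · p v + (b + - (a · p v)) + t * c   ≡⟨ cong (_+ t * c) (solve 2 (λ A b → A :+ (b :+ :- A) := b) refl (a · p v) b) ⟩
      b′                                    ∎
      where open ≡-Reasoning
            E = h · p v + - c

    tilt-≤ : ∀ i → i ≢ v → a · p i ≤ b → a′ · p i ≤ b′
    tilt-≤ i i≢v ai≤b = subst (_≤ b′) (sym (tilt-base i i≢v)) (+-monoˡ-≤ (t * c) ai≤b)

    tilt-< : ∀ i → i ≢ v → a · p i < b → a′ · p i < b′
    tilt-< i i≢v ai<b = subst (_< b′) (sym (tilt-base i i≢v)) (+-mono-< (t * c) ai<b)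

    tilt-> : ∀ i → i ≢ v → b < a · p i → b′ < a′ · p i
    tilt-> i i≢v b<ai = subst (b′ <_) (sym (tilt-base i i≢v)) (+-mono-< (t * c) b<ai)

    tilt-≡ : ∀ i → i ≢ v → a · p i ≡ b ⇔ a′ · p i ≡ b′
    tilt-≡ i i≢v = mk⇔ (λ ai≡b → trans (tilt-base i i≢v) (cong (_+ t * c) ai≡b))
                       (λ a′i≡b′ → +-cancelʳ (t * c) _ _ (trans (sym (tilt-base i i≢v)) a′i≡b′))

    tilt-bounds : ∀ {B} → (∀ i → i ∈ B → a · p i ≤ b) → ∀ i → i ∈ B ∪ ⁅ v ⁆ → a′ · p i ≤ b′
    tilt-bounds B≤b i i∈ with i ≟ v
    ... | yes refl = inj₂ tilt-apex
    ... | no i≢v = tilt-≤ i i≢v (B≤b i (x∈p∪⁅y⁆∧x≢y⇒x∈p i∈ i≢v))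

    tilt-OnHyperplane : ∀ {G} → OnHyperplane G a b → OnHyperplane (G ∪ ⁅ v ⁆) a′ b′
    tilt-OnHyperplane G⊆H i i∈ with i ≟ v
    ... | yes refl = tilt-apex
    ... | no i≢v = to (tilt-≡ i i≢v) (G⊆H i (x∈p∪⁅y⁆∧x≢y⇒x∈p i∈ i≢v))

  Face⇒bounded : ∀ {B G} → v ∉ B → Face B G →
                 ∃ λ a → ∃ λ b → (∀ i → i ∈ B → a · p i ≤ b) × (∀ i → i ∈ G ⇔ (i ∈ B × a · p i ≡ b))
  Face⇒bounded v∉B (inj₂ (a , b , _ , B≤b , G≡B∩H)) = a , b , B≤b , G≡B∩H
  Face⇒bounded {B} {G} v∉B (inj₁ G≡∅) =
    h , c + 1# , B≤c+1 , λ i → mk⇔ (λ i∈G → ⊥-elim (G≡∅ i i∈G)) (from′ i)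
    where
    B≤c+1 : ∀ i → i ∈ B → h · p i ≤ c + 1#
    B≤c+1 i i∈B = inj₁ (subst (_< c + 1#) (sym (base⊆H i (v∉⇒≢v v∉B i∈B))) (x<x+1 c))
    from′ : ∀ i → i ∈ B × h · p i ≡ c + 1# → i ∈ G
    from′ i (i∈B , hi≡c+1) = ⊥-elim (<⇒≢ (x<x+1 c) (trans (sym (base⊆H i (v∉⇒≢v v∉B i∈B))) hi≡c+1))

  facet-cone : ∀ {B G} → v ∉ B → Facet B G → Facet (B ∪ ⁅ v ⁆) (G ∪ ⁅ v ⁆)
  facet-cone {B} {G} v∉B (G-face , r , rankB , rankG) with Face⇒bounded v∉B G-face
  ... | a , b , B≤b , G≡B∩H = G∪v-face , suc r , AffRank-cone v∉B rankB , AffRank-cone (v∉B ∘ Face⇒⊆ G-face) rankG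
    where
    open Tilt a b
    -- if the tilted functional vanished, every point of B would lie in G, against rank G < rank B
    a′≢0 : ∃ λ k → a′ k ≢ 0#
    a′≢0 with zero⊎nonzero a′
    ... | inj₂ a′≢0 = a′≢0
    ... | inj₁ a′≡0 = ⊥-elim (ℕ.1+n≢n (AffRank-unique rankB (subst (λ X → AffRank X r) G≡B rankG)))
      where
      B⊆G : B ⊆ G
      B⊆G {i} i∈B = from (G≡B∩H i) (i∈B , from (tilt-≡ i (v∉⇒≢v v∉B i∈B))
                      (trans (·-zeroˡ (p i) a′≡0) (trans (sym (·-zeroˡ (p v) a′≡0)) tilt-apex)))
      G≡B : G ≡ B
      G≡B = ⊆-antisym (Face⇒⊆ G-face) B⊆G
    G∪v-face : Face (B ∪ ⁅ v ⁆) (G ∪ ⁅ v ⁆)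
    G∪v-face = inj₂ (a′ , b′ , a′≢0 , tilt-bounds B≤b , λ i → mk⇔ (to′ i) (from′ i))
      where
      to′ : ∀ i → i ∈ G ∪ ⁅ v ⁆ → i ∈ B ∪ ⁅ v ⁆ × a′ · p i ≡ b′
      to′ i i∈ = ∪⁅⁆-monoˡ (Face⇒⊆ G-face) i∈ ,
                 tilt-OnHyperplane (λ j j∈G → proj₂ (to (G≡B∩H j) j∈G)) i i∈
      from′ : ∀ i → i ∈ B ∪ ⁅ v ⁆ × a′ · p i ≡ b′ → i ∈ G ∪ ⁅ v ⁆
      from′ i (i∈ , a′i≡b′) with i ≟ v
      ... | yes refl = y∈p∪⁅y⁆ G i
      ... | no i≢v =
        x∈p∪q⁺ (inj₁ (from (G≡B∩H i) (x∈p∪⁅y⁆∧x≢y⇒x∈p i∈ i≢v , from (tilt-≡ i i≢v) a′i≡b′)))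

  Visible-cone⁻¹ : ∀ {Y G u} → v ∉ Y → u ≢ v → Facet (Y ∪ ⁅ v ⁆) G → Visible (Y ∪ ⁅ v ⁆) G u →
                   ∃ λ G′ → G ≡ G′ ∪ ⁅ v ⁆ × Facet Y G′ × Visible Y G′ u
  Visible-cone⁻¹ {Y} {G} {u} v∉Y u≢v G-facet (_ , u∈aff , a , b , Y∪v≤b , G⊆H , _ , b<au) with v ∈? G
  ... | no v∉G = ⊥-elim (<⇒≢ b<au (sym (InAff-OnHyperplane (λ i i∈Y → G⊆H i (subst (i ∈_) (sym G≡Y) i∈Y)) u∈affY)))
    where
    G≡Y = facet-avoiding-apex v∉Y G-facet v∉G
    u∈affY = InAff-cone⁻¹ u≢v u∈aff
  ... | yes v∈G = G - v , sym (p-x∪⁅x⁆≡p v∈G) , G-v-facet ,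
                  (G-v-facet , u∈affY , a , b , Y≤b , (λ i i∈ → G⊆H i (x∈p-y⇒x∈p i∈)) ,
                   strictly-below Y≤b u∈affY b<au , b<au)
    where
    u∈affY = InAff-cone⁻¹ u≢v u∈aff
    G-v-facet = facet-through-apex v∉Y G-facet v∈G
    Y≤b : ∀ i → i ∈ Y → a · p i ≤ b
    Y≤b i i∈Y = Y∪v≤b i (x∈p∪q⁺ (inj₁ i∈Y))

  Visible-cone : ∀ {Y G u} → v ∉ Y → u ≢ v → Facet Y G → Visible Y G u →
                 Facet (Y ∪ ⁅ v ⁆) (G ∪ ⁅ v ⁆) × Visible (Y ∪ ⁅ v ⁆) (G ∪ ⁅ v ⁆) u
  Visible-cone {Y} {G} {u} v∉Y u≢v G-facet (_ , u∈aff , a , b , Y≤b , G⊆H , (i , i∈Y , ai<b) , b<au) =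
    G∪v-facet , G∪v-facet , InAff-mono (λ j∈Y → x∈p∪q⁺ (inj₁ j∈Y)) u∈aff , a′ , b′ , tilt-bounds Y≤b ,
    tilt-OnHyperplane G⊆H , (i , x∈p∪q⁺ (inj₁ i∈Y) , tilt-< i (v∉⇒≢v v∉Y i∈Y) ai<b) , tilt-> u u≢v b<au
    where
    open Tilt a b
    G∪v-facet = facet-cone v∉Y G-facet

module Runs (F : OrderedField) {d n : ℕ} (p : Fin n → Fin d → OrderedField.Carrier F) where
  open Geometry F p
  open Equivalence using (to; from)
  module ⇔ = IsEquivalence (⇔-isEquivalence {ℓ = 0ℓ})

  ≐-refl : ∀ {C} → C ≐ C
  ≐-refl S = ⇔.refl

  ≐-sym : ∀ {C D} → C ≐ D → D ≐ C
  ≐-sym C≐D S = ⇔.sym (C≐D S)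

  ≐-trans : ∀ {C D E} → C ≐ D → D ≐ E → C ≐ E
  ≐-trans C≐D D≐E S = ⇔.trans (C≐D S) (D≐E S)

  pull-mono : ∀ u {C D} → (∀ S → C S → D S) → ∀ S → pull u C S → pull u D S
  pull-mono u C⊆D S (inj₁ (CS , u∉S)) = inj₁ (C⊆D S CS , u∉S)
  pull-mono u C⊆D S (inj₂ (Sⱼ , CSⱼ , rest)) = inj₂ (Sⱼ , C⊆D Sⱼ CSⱼ , rest)

  push-mono : ∀ u {C D} → (∀ S → C S → D S) → ∀ S → push u C S → push u D S
  push-mono u C⊆D S (inj₁ (CS , u∉S)) = inj₁ (C⊆D S CS , u∉S)
  push-mono u C⊆D S (inj₂ (inj₁ (CS , rest))) = inj₂ (inj₁ (C⊆D S CS , rest))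
  push-mono u C⊆D S (inj₂ (inj₂ (Sⱼ , CSⱼ , rest))) = inj₂ (inj₂ (Sⱼ , C⊆D Sⱼ CSⱼ , rest))

  step-cong : ∀ b u {C D} → C ≐ D → step b u C ≐ step b u D
  step-cong true u C≐D S = mk⇔ (pull-mono u (λ S → to (C≐D S)) S) (pull-mono u (λ S → from (C≐D S)) S)
  step-cong false u C≐D S = mk⇔ (push-mono u (λ S → to (C≐D S)) S) (push-mono u (λ S → from (C≐D S)) S)

  run-cong : ∀ L c {C D} → C ≐ D → run L c C ≐ run L c D
  run-cong [] c C≐D = C≐D
  run-cong (u ∷ L) c C≐D = run-cong L c (step-cong (c u) u C≐D)

  run-cong-choice : ∀ L {c c′} C → (∀ u → u List.∈ L → c u ≡ c′ u) → run L c C ≡ run L c′ C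
  run-cong-choice [] C _ = refl
  run-cong-choice (u ∷ L) {c′ = c′} C c≡c′ rewrite c≡c′ u (here refl) =
    run-cong-choice L (step (c′ u) u C) (λ w w∈L → c≡c′ w (there w∈L))

module ConeSubdivisions (F : OrderedField) {d n : ℕ} (p : Fin n → Fin d → OrderedField.Carrier F) (v : Fin n)
                        (h : Fin d → OrderedField.Carrier F) (c : OrderedField.Carrier F)
                        (base⊆H : ∀ i → i ≢ v → Geometry._·_ F p h (p i) ≡ c)
                        (apex<c : OrderedField._<_ F (Geometry._·_ F p h (p v)) c) where
  open Pyramid F p v h c base⊆H apex<c
  open SubsetProperties
  open Equivalence using (to; from)
  open Runs F p
  open OrderProperties v

  Cone : Coll → Coll
  Cone D S = ∃ λ B → D B × S ≡ B ∪ ⁅ v ⁆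

  AvoidsApex : Coll → Set
  AvoidsApex D = ∀ B → D B → v ∉ B

  pull-apex : ∀ D → AvoidsApex D → pull v (Cone D) ≐ Cone D
  pull-apex D avoids S = mk⇔ (to′ S) (from′ S)
    where
    to′ : ∀ S → pull v (Cone D) S → Cone D S
    to′ _ (inj₁ ((B , _ , refl) , v∉S)) = ⊥-elim (v∉S (y∈p∪⁅y⁆ B v))
    to′ _ (inj₂ (_ , (B , DB , refl) , _ , G , G-facet , v∉G , refl)) =
      B , DB , cong (_∪ ⁅ v ⁆) (facet-avoiding-apex (avoids B DB) G-facet v∉G)
    from′ : ∀ S → Cone D S → pull v (Cone D) S
    from′ _ (B , DB , refl) =
      inj₂ (B ∪ ⁅ v ⁆ , (B , DB , refl) , y∈p∪⁅y⁆ B v , B , base-facet (avoids B DB) , avoids B DB , refl)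

  push-apex : ∀ D → AvoidsApex D → push v (Cone D) ≐ Cone D
  push-apex D avoids S = mk⇔ (to′ S) (from′ S)
    where
    to′ : ∀ S → push v (Cone D) S → Cone D S
    to′ _ (inj₁ ((B , _ , refl) , v∉S)) = ⊥-elim (v∉S (y∈p∪⁅y⁆ B v))
    to′ _ (inj₂ (inj₁ (cone , _ , _))) = cone
    to′ _ (inj₂ (inj₂ (_ , (B , DB , refl) , _ , ¬drops , _))) = ⊥-elim (¬drops (DropsDim-apex (avoids B DB)))
    from′ : ∀ S → Cone D S → push v (Cone D) S
    from′ _ cone@(B , DB , refl) = inj₂ (inj₁ (cone , y∈p∪⁅y⁆ B v , DropsDim-apex (avoids B DB)))

  step-apex : ∀ b D → AvoidsApex D → step b v (Cone D) ≐ Cone D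
  step-apex true = pull-apex
  step-apex false = push-apex

  module _ {u} (u≢v : u ≢ v) where

    pull-base : ∀ D → AvoidsApex D → pull u (Cone D) ≐ Cone (pull u D)
    pull-base D avoids S = mk⇔ (to′ S) (from′ S)
      where
      to′ : ∀ S → pull u (Cone D) S → Cone (pull u D) S
      to′ _ (inj₁ ((B , DB , refl) , u∉S)) = B , inj₁ (DB , u∉S ∘ λ u∈B → x∈p∪q⁺ (inj₁ u∈B)) , refl
      to′ _ (inj₂ (_ , (B , DB , refl) , u∈S , G , G-facet , u∉G , refl)) with v ∈? G
      ... | no v∉G = ⊥-elim (u∉G (subst (u ∈_) (sym (facet-avoiding-apex (avoids B DB) G-facet v∉G)) u∈B))
        where u∈B = x∈p∪⁅y⁆∧x≢y⇒x∈p u∈S u≢v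
      ... | yes v∈G =
        (G - v) ∪ ⁅ u ⁆ ,
        inj₂ (B , DB , u∈B , G - v , facet-through-apex (avoids B DB) G-facet v∈G , u∉G ∘ x∈p-y⇒x∈p , refl) ,
        trans (cong (_∪ ⁅ u ⁆) (sym (p-x∪⁅x⁆≡p v∈G))) (∪⁅⁆-comm (G - v) v u)
        where u∈B = x∈p∪⁅y⁆∧x≢y⇒x∈p u∈S u≢v
      from′ : ∀ S → Cone (pull u D) S → pull u (Cone D) S
      from′ _ (B , inj₁ (DB , u∉B) , refl) = inj₁ ((B , DB , refl) , x∉p∧x≢y⇒x∉p∪⁅y⁆ u∉B u≢v)
      from′ _ (_ , inj₂ (B , DB , u∈B , G , G-facet , u∉G , refl) , refl) =
        inj₂ (B ∪ ⁅ v ⁆ , (B , DB , refl) , x∈p∪q⁺ (inj₁ u∈B) , G ∪ ⁅ v ⁆ , facet-cone (avoids B DB) G-facet ,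
              x∉p∧x≢y⇒x∉p∪⁅y⁆ u∉G u≢v , ∪⁅⁆-comm G u v)

    push-cone⊆cone-push : ∀ D → AvoidsApex D → ∀ S → push u (Cone D) S → Cone (push u D) S
    push-cone⊆cone-push D avoids _ (inj₁ ((B , DB , refl) , u∉S)) =
      B , inj₁ (DB , u∉S ∘ λ u∈B → x∈p∪q⁺ (inj₁ u∈B)) , refl
    push-cone⊆cone-push D avoids _ (inj₂ (inj₁ ((B , DB , refl) , u∈S , drops))) =
      B , inj₂ (inj₁ (DB , x∈p∪⁅y⁆∧x≢y⇒x∈p u∈S u≢v , to (DropsDim-cone (avoids B DB) u≢v) drops)) , refl
    push-cone⊆cone-push D avoids _ (inj₂ (inj₂ (_ , (B , DB , refl) , u∈S , ¬drops , inj₁ refl))) =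
      B - u ,
      inj₂ (inj₂ (B , DB , x∈p∪⁅y⁆∧x≢y⇒x∈p u∈S u≢v , ¬drops ∘ from (DropsDim-cone (avoids B DB) u≢v) , inj₁ refl)) ,
      p∪⁅x⁆-y≡p-y∪⁅x⁆ u≢v
    push-cone⊆cone-push D avoids _ (inj₂ (inj₂ (_ , (B , DB , refl) , u∈S , ¬drops , inj₂ (G , G-facet , G-visible , refl))))
      with Visible-cone⁻¹ (avoids B DB ∘ x∈p-y⇒x∈p) u≢v (subst (λ X → Facet X G) (p∪⁅x⁆-y≡p-y∪⁅x⁆ u≢v) G-facet)
                                                        (subst (λ X → Visible X G u) (p∪⁅x⁆-y≡p-y∪⁅x⁆ u≢v) G-visible)
    ... | G′ , refl , G′-facet , G′-visible =
      G′ ∪ ⁅ u ⁆ ,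
      inj₂ (inj₂ (B , DB , x∈p∪⁅y⁆∧x≢y⇒x∈p u∈S u≢v , ¬drops ∘ from (DropsDim-cone (avoids B DB) u≢v) ,
                  inj₂ (G′ , G′-facet , G′-visible , refl))) ,
      ∪⁅⁆-comm G′ v u

    cone-push⊆push-cone : ∀ D → AvoidsApex D → ∀ S → Cone (push u D) S → push u (Cone D) S
    cone-push⊆push-cone D avoids _ (B , inj₁ (DB , u∉B) , refl) = inj₁ ((B , DB , refl) , x∉p∧x≢y⇒x∉p∪⁅y⁆ u∉B u≢v)
    cone-push⊆push-cone D avoids _ (B , inj₂ (inj₁ (DB , u∈B , drops)) , refl) =
      inj₂ (inj₁ ((B , DB , refl) , x∈p∪q⁺ (inj₁ u∈B) , from (DropsDim-cone (avoids B DB) u≢v) drops))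
    cone-push⊆push-cone D avoids _ (_ , inj₂ (inj₂ (B , DB , u∈B , ¬drops , inj₁ refl)) , refl) =
      inj₂ (inj₂ (B ∪ ⁅ v ⁆ , (B , DB , refl) , x∈p∪q⁺ (inj₁ u∈B) , ¬drops ∘ to (DropsDim-cone (avoids B DB) u≢v) ,
                  inj₁ (sym (p∪⁅x⁆-y≡p-y∪⁅x⁆ u≢v))))
    cone-push⊆push-cone D avoids _ (_ , inj₂ (inj₂ (B , DB , u∈B , ¬drops , inj₂ (G , G-facet , G-visible , refl))) , refl) =
      inj₂ (inj₂ (B ∪ ⁅ v ⁆ , (B , DB , refl) , x∈p∪q⁺ (inj₁ u∈B) , ¬drops ∘ to (DropsDim-cone (avoids B DB) u≢v) ,
                  inj₂ (G ∪ ⁅ v ⁆ , subst (λ X → Facet X (G ∪ ⁅ v ⁆)) (sym (p∪⁅x⁆-y≡p-y∪⁅x⁆ u≢v)) (proj₁ G∪v-facet×visible) ,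
                        subst (λ X → Visible X (G ∪ ⁅ v ⁆) u) (sym (p∪⁅x⁆-y≡p-y∪⁅x⁆ u≢v)) (proj₂ G∪v-facet×visible) ,
                        ∪⁅⁆-comm G u v)))
      where
      G∪v-facet×visible = Visible-cone (avoids B DB ∘ x∈p-y⇒x∈p) u≢v G-facet G-visible

    push-base : ∀ D → AvoidsApex D → push u (Cone D) ≐ Cone (push u D)
    push-base D avoids S = mk⇔ (push-cone⊆cone-push D avoids S) (cone-push⊆push-cone D avoids S)

    step-base : ∀ b D → AvoidsApex D → step b u (Cone D) ≐ Cone (step b u D)
    step-base true = pull-base
    step-base false = push-base

    AvoidsApex-step : ∀ b D → AvoidsApex D → AvoidsApex (step b u D)
    AvoidsApex-step true D avoids B (inj₁ (DB , _)) = avoids B DB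
    AvoidsApex-step true D avoids _ (inj₂ (B , DB , _ , G , G-facet , _ , refl)) =
      x∉p∧x≢y⇒x∉p∪⁅y⁆ (avoids B DB ∘ Facet⇒⊆ G-facet) (u≢v ∘ sym)
    AvoidsApex-step false D avoids B (inj₁ (DB , _)) = avoids B DB
    AvoidsApex-step false D avoids B (inj₂ (inj₁ (DB , _))) = avoids B DB
    AvoidsApex-step false D avoids _ (inj₂ (inj₂ (B , DB , _ , _ , inj₁ refl))) = avoids B DB ∘ x∈p-y⇒x∈p
    AvoidsApex-step false D avoids _ (inj₂ (inj₂ (B , DB , _ , _ , inj₂ (G , G-facet , _ , refl)))) =
      x∉p∧x≢y⇒x∉p∪⁅y⁆ (avoids B DB ∘ x∈p-y⇒x∈p ∘ Facet⇒⊆ G-facet) (u≢v ∘ sym)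

  run-cone : ∀ c L D → AvoidsApex D → run L c (Cone D) ≐ Cone (run (without v L) c D)
  run-cone c [] D avoids = ≐-refl
  -- abstracting over u ≟ v also evaluates the filter in 'without v (u ∷ L)'
  run-cone c (u ∷ L) D avoids with u ≟ v
  ... | yes refl = ≐-trans (run-cong L c (step-apex (c u) D avoids)) (run-cone c L D avoids)
  ... | no u≢v = ≐-trans (run-cong L c (step-base u≢v (c u) D avoids))
                         (run-cone c L (step (c u) u D) (AvoidsApex-step u≢v (c u) D avoids))

  lex≐cone : ∀ L c → lex ⊤ L c ≐ Cone (lex (⊤ - v) (without v L) c)
  lex≐cone L c = ≐-trans (run-cong L c trivial≐cone) (run-cone c L (trivial (⊤ - v)) (λ { _ refl → x∉p-x }))
    where
    trivial≐cone : trivial ⊤ ≐ Cone (trivial (⊤ - v))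
    trivial≐cone S = mk⇔ (λ { refl → ⊤ - v , refl , sym (p-x∪⁅x⁆≡p ∈⊤) })
                         (λ { (_ , refl , refl) → p-x∪⁅x⁆≡p ∈⊤ })

  lex-determined-by-base : ∀ {L L′ c c′} → without v L′ ≡ without v L → (∀ i → i ≢ v → c′ i ≡ c i) →
                           lex ⊤ L′ c′ ≐ lex ⊤ L c
  lex-determined-by-base {L} {L′} {c} {c′} same-order same-choices =
    ≐-trans (lex≐cone L′ c′) (subst (λ C → Cone C ≐ lex ⊤ L c) (sym same-base) (≐-sym (lex≐cone L c)))
    where
    same-base : lex (⊤ - v) (without v L′) c′ ≡ lex (⊤ - v) (without v L) c
    same-base = trans (cong (λ L → lex (⊤ - v) L c′) same-order)
                      (run-cong-choice (without v L) (trivial (⊤ - v)) (λ u u∈ → same-choices u (∈-without⇒≢ L u∈)))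

lemma5p7 : (F : OrderedField) {d n : ℕ}
    (p : Fin n → Fin d → OrderedField.Carrier F)
    → Injective _≡_ _≡_ p
    → (v : Fin n)
    → Geometry.AffRank F p ⊤ (suc d)
    → Geometry.AffRank F p (⊤ - v) d
    → (ord : List (Fin n)) (c : Fin n → Bool)
    → IsOrderOf ⊤ ord
    → ((k : ℕ) (c' : Fin n → Bool) → (∀ i → i ≢ v → c' i ≡ c i)
         → Geometry._≐_ F p (Geometry.lex F p ⊤ (insertAt k v (without v ord)) c')
                            (Geometry.lex F p ⊤ ord c))
      × Geometry._≐_ F p (Geometry.lex F p ⊤ ord c)
          (λ S → ∃ λ B → Geometry.lex F p (⊤ - v) (without v ord) c B
                         × S ≡ B ∪ ⁅ v ⁆)
lemma5p7 F p _ v rank⊤ rank-base ord c _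
  with ApexSeparation.apexSeparator F p v rank⊤ rank-base
... | h , c₀ , base⊆H , apex<c₀ =
  (λ k c′ c′≡c → lex-determined-by-base {ord} {insertAt k v (without v ord)} (without-insertAt k ord) c′≡c) ,
  lex≐cone ord c
  where
  open OrderProperties v
  open ConeSubdivisions F p v h c₀ base⊆H apex<c₀
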